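{- If $S^\#$ is a c.e. presentation of an abelian semigroup $S$, then there is a c.e. presentation $\mathcal{G}(S^\#)$ of the Grothendieck group $\mathcal{G}(S)$ that is $S^\#$-universal (and such a presentation is unique up to computable isomorphism).
   Context: Let $D_\omega$, $F_\omega$ be the free semigroup and free group on $x_0,x_1,\ldots$, computably identified with $\mathbb{N}$. A presentation of a semigroup $S$ (resp. group $G$) is an epimorphism $\nu:D_\omega\to S$ (resp. $\nu:F_\omega\to G$); $w$ is a label of $\nu(w)$; it is c.e. (computable) if $\{(w,w'):\nu(w)=\nu(w')\}$ is c.e. (computable). A homomorphism $f$ is a computable map between presentations if a computable function on words sends each label of $a$ to a label of $f(a)$ (a code of it is an index of $f$); presentations are computably isomorphic if some isomorphism is computable in both directions. $\mathcal{G}(S)$ is the Grothendieck group $(S\times S)/\!\sim$ where $(a,b)\sim(c,d)$ iff $a+d+z=c+b+z$ for some $z\in S$, with canonical map $\gamma_S(a)=[(a+b,b)]$. A presentation $\mathcal{G}(S)^\#$ of $\mathcal{G}(S)$ is $S^\#$-universal if $\gamma_S$ is a computable map from $S^\#$ to $\mathcal{G}(S)^\#$, and whenever $H^\#$ is a c.e. presentation of an abelian group and $\phi$ is a semigroup homomorphism that is a computable map from $S^\#$ to $H^\#$, the unique group homomorphism $\psi_\phi:\mathcal{G}(S)\to H$ with $\psi_\phi\circ\gamma_S=\phi$ is a computable map from $\mathcal{G}(S)^\#$ to $H^\#$, with an index computable from an index of $\phi$. -}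

module Defs where

open import Level using (Level; _⊔_; Setω) renaming (suc to lsuc)
open import Data.Nat using (ℕ; zero; suc; _+_; _<_; _%_; _/_)
open import Data.Product using (Σ; ∃; _×_; _,_; proj₁; proj₂)
open import Data.List using (List; []; _∷_)
open import Data.List.NonEmpty using (List⁺; _∷_)
open import Function.Bundles using (_⇔_)
open import Relation.Binary.Core using (Rel)
open import Algebra.Bundles using (CommutativeSemigroup; AbelianGroup)
open import Algebra.Bundles.Raw using (RawGroup)
open import Algebra.Morphism.Structures
  using (module MagmaMorphisms; module GroupMorphisms)

tri : ℕ → ℕ
tri zero    = zero
tri (suc d) = suc d + tri d

-- ⟨a , b⟩ = tri (a + b) + b  (enumerates diagonals (d,0),(d-1,1),…,(0,d))
pair : ℕ → ℕ → ℕ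
pair a b = tri (a + b) + b

nextPair : ℕ × ℕ → ℕ × ℕ
nextPair (zero  , b) = (suc b , zero)
nextPair (suc a , b) = (a , suc b)

-- inverse of pair: unpair n is the n-th pair of the enumeration
unpair : ℕ → ℕ × ℕ
unpair zero    = (zero , zero)
unpair (suc n) = nextPair (unpair n)

fst snd : ℕ → ℕ
fst n = proj₁ (unpair n)
snd n = proj₂ (unpair n)

-- Partial recursive (μ-recursive) functions, unary via pairing

data Code : Set where
  cZero cSucc cFst cSnd : Code
  cPair cComp cRec      : Code → Code → Code
  cMu                   : Code → Code

mutual
  data _⊢_⇓_ : Code → ℕ → ℕ → Set where
    ev-zero : ∀ {x} → cZero ⊢ x ⇓ zero
    ev-succ : ∀ {x} → cSucc ⊢ x ⇓ suc x
    ev-fst  : ∀ {x} → cFst ⊢ x ⇓ fst x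
    ev-snd  : ∀ {x} → cSnd ⊢ x ⇓ snd x
    ev-pair : ∀ {f g x a b} → f ⊢ x ⇓ a → g ⊢ x ⇓ b → cPair f g ⊢ x ⇓ pair a b
    ev-comp : ∀ {f g x y z} → g ⊢ x ⇓ y → f ⊢ y ⇓ z → cComp f g ⊢ x ⇓ z
    ev-rec  : ∀ {f g x y} → Rec f g (fst x) (snd x) y → cRec f g ⊢ x ⇓ y
    ev-mu   : ∀ {f x n} → f ⊢ pair x n ⇓ zero
            → (∀ m → m < n → Σ ℕ λ k → f ⊢ pair x m ⇓ suc k)
            → cMu f ⊢ x ⇓ n

  data Rec (f g : Code) (a : ℕ) : ℕ → ℕ → Set where
    rec-zero : ∀ {y} → f ⊢ a ⇓ y → Rec f g a zero y
    rec-suc  : ∀ {n y z} → Rec f g a n y → g ⊢ pair a (pair n y) ⇓ z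
             → Rec f g a (suc n) z

-- Gödel numbering of programs (fuel-bounded decoding; fuel n suffices)
decodeCode′ : ℕ → ℕ → Code
decodeCode′ zero     n = cZero
decodeCode′ (suc k) n with unpair n
... | (0 , r) = cZero
... | (1 , r) = cSucc
... | (2 , r) = cFst
... | (3 , r) = cSnd
... | (4 , r) = cPair (decodeCode′ k (fst r)) (decodeCode′ k (snd r))
... | (5 , r) = cComp (decodeCode′ k (fst r)) (decodeCode′ k (snd r))
... | (6 , r) = cRec  (decodeCode′ k (fst r)) (decodeCode′ k (snd r))
... | (7 , r) = cMu   (decodeCode′ k r)
... | (_ , r) = cZero

decodeCode : ℕ → Code
decodeCode n = decodeCode′ n n

Φ : ℕ → ℕ → ℕ → Set
Φ e x y = decodeCode e ⊢ x ⇓ y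

CERel : ∀ {ℓ} → Rel ℕ ℓ → Set ℓ
CERel R = Σ ℕ λ e → ∀ a b → R a b ⇔ (Σ ℕ λ y → Φ e (pair a b) y)

decodeList′ : ℕ → ℕ → List ℕ
decodeList′ zero    _       = []
decodeList′ (suc k) zero    = []
decodeList′ (suc k) (suc m) = fst m ∷ decodeList′ k (snd m)

decodeList : ℕ → List ℕ
decodeList n = decodeList′ n n

-- words of the free semigroup D_ω (nonempty words over x₀, x₁, …)
decodeD : ℕ → List⁺ ℕ
decodeD n = fst n ∷ decodeList (snd n)

data Letter : Set where
  gen inv : ℕ → Letter

decodeLetter : ℕ → Letter
decodeLetter k with k % 2
... | zero = gen (k / 2)
... | _    = inv (k / 2)

mapL : List ℕ → List Letter
mapL []       = []
mapL (k ∷ ks) = decodeLetter k ∷ mapL ks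

-- words of the free group F_ω (not necessarily reduced)
decodeF : ℕ → List Letter
decodeF n = mapL (decodeList n)

module _ {c ℓ} (S : CommutativeSemigroup c ℓ) where
  open CommutativeSemigroup S

  evalD′ : (ℕ → Carrier) → ℕ → List ℕ → Carrier
  evalD′ g x []       = g x
  evalD′ g x (y ∷ ys) = g x ∙ evalD′ g y ys

  evalD : (ℕ → Carrier) → List⁺ ℕ → Carrier
  evalD g (x ∷ xs) = evalD′ g x xs

  record SemigroupPres : Set (c ⊔ ℓ) where
    field
      gens : ℕ → Carrier
      surj : ∀ s → Σ (List⁺ ℕ) λ w → evalD gens w ≈ s
    label : ℕ → Carrier
    label n = evalD gens (decodeD n)

  CESemigroupPres : SemigroupPres → Set ℓ
  CESemigroupPres P = CERel (λ a b → label a ≈ label b)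
    where open SemigroupPres P

module _ {c ℓ} (G : RawGroup c ℓ) where
  open RawGroup G

  evalF : (ℕ → Carrier) → List Letter → Carrier
  evalF g []            = ε
  evalF g (gen i ∷ w)   = g i ∙ evalF g w
  evalF g (inv i ∷ w)   = (g i) ⁻¹ ∙ evalF g w

  record GroupPres : Set (c ⊔ ℓ) where
    field
      gens : ℕ → Carrier
      surj : ∀ x → Σ (List Letter) λ w → evalF gens w ≈ x
    label : ℕ → Carrier
    label n = evalF gens (decodeF n)

  CEGroupPres : GroupPres → Set ℓ
  CEGroupPres P = CERel (λ a b → label a ≈ label b)
    where open GroupPres P

IsIndex : ∀ {a b ℓ} {A : Set a} {B : Set b} (_≈_ : Rel B ℓ)
          (L₁ : ℕ → A) (L₂ : ℕ → B) (f : A → B) (e : ℕ) → Set ℓ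
IsIndex _≈_ L₁ L₂ f e = ∀ n → Σ ℕ λ m → Φ e n m × (f (L₁ n) ≈ L₂ m)

module _ {c ℓ} (S : CommutativeSemigroup c ℓ) where
  open CommutativeSemigroup S

  _∼_ : Rel (Carrier × Carrier) (c ⊔ ℓ)
  (a , b) ∼ (c′ , d) = Σ Carrier λ z → (a ∙ d) ∙ z ≈ (c′ ∙ b) ∙ z

  -- s₀ is any element of S, used to represent the identity [(s₀,s₀)]
  Grothendieck : Carrier → RawGroup c (c ⊔ ℓ)
  Grothendieck s₀ = record
    { Carrier = Carrier × Carrier
    ; _≈_     = _∼_
    ; _∙_     = λ p q → (proj₁ p ∙ proj₁ q , proj₂ p ∙ proj₂ q)
    ; ε       = (s₀ , s₀)
    ; _⁻¹     = λ p → (proj₂ p , proj₁ p)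
    }

  -- γ_S(a) = [(a + b , b)], taking b = a
  γ : Carrier → Carrier × Carrier
  γ a = (a ∙ a , a)

module _ {c ℓ} (S : CommutativeSemigroup c ℓ) (S# : SemigroupPres S) where
  open CommutativeSemigroup S using (Carrier)
  private
    s₀ = SemigroupPres.gens S# 0
    𝒢 = Grothendieck S s₀
    module 𝒢 = RawGroup 𝒢

  Universal : (h ℓh : Level) → GroupPres 𝒢 → Set (c ⊔ ℓ ⊔ lsuc (h ⊔ ℓh))
  Universal h ℓh G# =
    (Σ ℕ λ e → IsIndex 𝒢._≈_ (SemigroupPres.label S#) (GroupPres.label G#) (γ S) e)
    × (Σ ℕ λ e →
        (H : AbelianGroup h ℓh) →
        let open AbelianGroup H using () renaming (Carrier to |H|; _≈_ to _≈H_)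
        in (H# : GroupPres (AbelianGroup.rawGroup H)) → CEGroupPres _ H# →
           (φ : Carrier → |H|) →
           MagmaMorphisms.IsMagmaHomomorphism
             (CommutativeSemigroup.rawMagma S) (AbelianGroup.rawMagma H) φ →
           (ψ : 𝒢.Carrier → |H|) →
           GroupMorphisms.IsGroupHomomorphism 𝒢 (AbelianGroup.rawGroup H) ψ →
           (∀ s → ψ (γ S s) ≈H φ s) →
           ∀ i → IsIndex _≈H_ (SemigroupPres.label S#) (GroupPres.label H#) φ i →
           Σ ℕ λ j → Φ e i j
                     × IsIndex _≈H_ (GroupPres.label G#) (GroupPres.label H#) ψ j)

  IsUniversal : GroupPres 𝒢 → Setω
  IsUniversal G# = ∀ {h ℓh} → Universal h ℓh G#

  ComputablyIsomorphic : GroupPres 𝒢 → GroupPres 𝒢 → Set (c ⊔ ℓ)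
  ComputablyIsomorphic P Q =
    Σ (𝒢.Carrier → 𝒢.Carrier) λ f → Σ (𝒢.Carrier → 𝒢.Carrier) λ g →
      GroupMorphisms.IsGroupHomomorphism 𝒢 𝒢 f
      × GroupMorphisms.IsGroupHomomorphism 𝒢 𝒢 g
      × (∀ x → g (f x) 𝒢.≈ x) × (∀ x → f (g x) 𝒢.≈ x)
      × (Σ ℕ λ e → IsIndex 𝒢._≈_ (GroupPres.label P) (GroupPres.label Q) f e)
      × (Σ ℕ λ e → IsIndex 𝒢._≈_ (GroupPres.label Q) (GroupPres.label P) g e)

  record UniversalGrothendieck : Setω where
    field
      pres      : GroupPres 𝒢
      pres-ce   : CEGroupPres 𝒢 pres
      universal : IsUniversal pres
      unique    : (P Q : GroupPres 𝒢) → CEGroupPres 𝒢 P → CEGroupPres 𝒢 Q →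
                  IsUniversal P → IsUniversal Q → ComputablyIsomorphic P Q

-- 𝒢(S) is presented by the images γ(x_i) of the generators of S#. An F_ω-word then denotes a formal
-- difference (a₊ , a₋) whose components are read off letter by letter as S-words, so [a] = [b] iff
-- (a₊ ∙ b₋) ∙ w = (b₊ ∙ a₋) ∙ w in S for some S-word w: an existential over a c.e. relation, which is
-- c.e. by dovetailing. Given an index of φ, the induced ψ sends a word to φ(a₊) φ(a₋)⁻¹, computed by
-- applying φ to both components. For H = 𝒢(S) and φ = γ the induced map is the identity, which gives
-- uniqueness up to computable isomorphism.
module Submission where

open import Algebra.Bundles using (CommutativeSemigroup; AbelianGroup)
open import Defs

module CantorPairing where
  open import Data.Nat
  open import Data.Nat.Properties
  open import Data.Product using (_,_; proj₁; proj₂)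
  open import Relation.Binary.PropositionalEquality

  pair-sucʳ : ∀ a b → pair a (suc b) ≡ suc (pair (suc a) b)
  pair-sucʳ a b rewrite +-suc a b = +-suc (tri (suc (a + b))) b

  pair-sucˡ-zero : ∀ a → pair (suc a) 0 ≡ suc (pair 0 a)
  pair-sucˡ-zero a rewrite +-identityʳ a | +-identityʳ (suc (a + tri a)) =
    cong suc (+-comm a (tri a))

  unpair-pair : ∀ a b → unpair (pair a b) ≡ (a , b)
  unpair-pair a b = onDiagonal (a + b) a b refl
    where
    onDiagonal : ∀ d a b → a + b ≡ d → unpair (pair a b) ≡ (a , b)
    onDiagonal d       zero    zero    _  = refl
    onDiagonal zero    (suc a) zero    ()
    onDiagonal (suc d) (suc a) zero    eq = begin
      unpair (pair (suc a) 0) ≡⟨ cong unpair (pair-sucˡ-zero a) ⟩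
      nextPair (unpair (pair 0 a)) ≡⟨ cong nextPair (onDiagonal d 0 a (trans (sym (+-identityʳ a)) (suc-injective eq))) ⟩
      (suc a , 0) ∎
      where open ≡-Reasoning
    onDiagonal d       a       (suc b) eq = begin
      unpair (pair a (suc b)) ≡⟨ cong unpair (pair-sucʳ a b) ⟩
      nextPair (unpair (pair (suc a) b)) ≡⟨ cong nextPair (onDiagonal d (suc a) b (trans (sym (+-suc a b)) eq)) ⟩
      (a , suc b) ∎
      where open ≡-Reasoning

  fst-pair : ∀ a b → fst (pair a b) ≡ a
  fst-pair a b = cong proj₁ (unpair-pair a b)

  snd-pair : ∀ a b → snd (pair a b) ≡ b
  snd-pair a b = cong proj₂ (unpair-pair a b)

  pair-fst-snd : ∀ n → pair (fst n) (snd n) ≡ n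
  pair-fst-snd zero = refl
  pair-fst-snd (suc n) with unpair n | pair-fst-snd n
  ... | zero  , b | eq = trans (pair-sucˡ-zero b) (cong suc eq)
  ... | suc a , b | eq = trans (pair-sucʳ a b) (cong suc eq)

  n≤tri-n : ∀ n → n ≤ tri n
  n≤tri-n zero    = z≤n
  n≤tri-n (suc n) = s≤s (m≤m+n n (tri n))

  m≤pair-m-n : ∀ a b → a ≤ pair a b
  m≤pair-m-n a b = ≤-trans (≤-trans (m≤m+n a b) (n≤tri-n (a + b))) (m≤m+n (tri (a + b)) b)

  n≤pair-m-n : ∀ a b → b ≤ pair a b
  n≤pair-m-n a b = m≤n+m b (tri (a + b))

  fst≤ : ∀ n → fst n ≤ n
  fst≤ n = subst (fst n ≤_) (pair-fst-snd n) (m≤pair-m-n (fst n) (snd n))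

  snd≤ : ∀ n → snd n ≤ n
  snd≤ n = subst (snd n ≤_) (pair-fst-snd n) (n≤pair-m-n (fst n) (snd n))

module Evaluation where
  open import Data.Nat
  open import Data.Nat.Properties using (<-cmp; 0≢1+n)
  open import Data.Product using (_,_; proj₂)
  open import Data.Empty using (⊥-elim)
  open import Relation.Binary.PropositionalEquality
  open import Relation.Binary.Definitions using (tri<; tri≈; tri>)
  open CantorPairing

  Computes : Code → (ℕ → ℕ) → Set
  Computes c F = ∀ x → c ⊢ x ⇓ F x

  ⇓-respʳ-≡ : ∀ {f x y y′} → f ⊢ x ⇓ y → y ≡ y′ → f ⊢ x ⇓ y′
  ⇓-respʳ-≡ d refl = d

  ev-fst-pair : ∀ {a b} → cFst ⊢ pair a b ⇓ a
  ev-fst-pair {a} {b} = ⇓-respʳ-≡ ev-fst (fst-pair a b)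

  ev-snd-pair : ∀ {a b} → cSnd ⊢ pair a b ⇓ b
  ev-snd-pair {a} {b} = ⇓-respʳ-≡ ev-snd (snd-pair a b)

  ev-rec-pair : ∀ {f g a n y} → Rec f g a n y → cRec f g ⊢ pair a n ⇓ y
  ev-rec-pair {f} {g} {a} {n} {y} r =
    ev-rec (subst₂ (λ a′ n′ → Rec f g a′ n′ y) (sym (fst-pair a n)) (sym (snd-pair a n)) r)

  mutual
    ⇓-deterministic : ∀ {f x y y′} → f ⊢ x ⇓ y → f ⊢ x ⇓ y′ → y ≡ y′
    ⇓-deterministic ev-zero         ev-zero         = refl
    ⇓-deterministic ev-succ         ev-succ         = refl
    ⇓-deterministic ev-fst          ev-fst          = refl
    ⇓-deterministic ev-snd          ev-snd          = refl
    ⇓-deterministic (ev-pair d₁ d₂) (ev-pair e₁ e₂) =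
      cong₂ pair (⇓-deterministic d₁ e₁) (⇓-deterministic d₂ e₂)
    ⇓-deterministic (ev-comp d₁ d₂) (ev-comp e₁ e₂) with ⇓-deterministic d₁ e₁
    ... | refl = ⇓-deterministic d₂ e₂
    ⇓-deterministic (ev-rec r)      (ev-rec r′)     = Rec-deterministic r r′
    ⇓-deterministic (ev-mu {n = n} d h) (ev-mu {n = n′} d′ h′) with <-cmp n n′
    ... | tri≈ _ eq _ = eq
    ... | tri< n<n′ _ _ = ⊥-elim (0≢1+n (⇓-deterministic d (proj₂ (h′ n n<n′))))
    ... | tri> _ _ n′<n = ⊥-elim (0≢1+n (⇓-deterministic d′ (proj₂ (h n′ n′<n))))

    Rec-deterministic : ∀ {f g a n y y′} → Rec f g a n y → Rec f g a n y′ → y ≡ y′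
    Rec-deterministic (rec-zero d)  (rec-zero d′)   = ⇓-deterministic d d′
    Rec-deterministic (rec-suc r d) (rec-suc r′ d′) with Rec-deterministic r r′
    ... | refl = ⇓-deterministic d d′

-- First-order expressions over ℕ, compiled to μ-recursive codes; programs are written in this language.
module Expressions where
  open import Data.Nat using (ℕ; zero; suc; pred)
  open import Data.Fin using (Fin; zero; suc)
  open import Data.Vec using (Vec; []; _∷_; lookup)
  open CantorPairing
  open Evaluation

  infixr 5 if0_then_else_

  data Expr : ℕ → Set where
    var            : ∀ {n} → Fin n → Expr n
    lit            : ∀ {n} → ℕ → Expr n
    succ dec π₁ π₂ : ∀ {n} → Expr n → Expr n
    ⟨_,_⟩          : ∀ {n} → Expr n → Expr n → Expr n
    if0_then_else_ : ∀ {n} → Expr n → Expr n → Expr n → Expr n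
    -- rec b s c: recursion on the value of c, the step s seeing (k ∷ previous ∷ environment)
    rec            : ∀ {n} → Expr n → Expr (suc (suc n)) → Expr n → Expr n
    app            : ∀ {n m} → Expr m → Vec (Expr n) m → Expr n

  x₀ : ∀ {n} → Expr (suc n)
  x₀ = var zero
  x₁ : ∀ {n} → Expr (suc (suc n))
  x₁ = var (suc zero)
  x₂ : ∀ {n} → Expr (suc (suc (suc n)))
  x₂ = var (suc (suc zero))
  x₃ : ∀ {n} → Expr (suc (suc (suc (suc n))))
  x₃ = var (suc (suc (suc zero)))

  ifZero : ℕ → ℕ → ℕ → ℕ
  ifZero zero    a b = a
  ifZero (suc _) a b = b

  mutual
    ⟦_⟧ : ∀ {n} → Expr n → Vec ℕ n → ℕ
    ⟦ var i ⟧                ρ = lookup ρ i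
    ⟦ lit k ⟧                ρ = k
    ⟦ succ e ⟧               ρ = suc (⟦ e ⟧ ρ)
    ⟦ dec e ⟧                ρ = pred (⟦ e ⟧ ρ)
    ⟦ π₁ e ⟧                 ρ = fst (⟦ e ⟧ ρ)
    ⟦ π₂ e ⟧                 ρ = snd (⟦ e ⟧ ρ)
    ⟦ ⟨ a , b ⟩ ⟧            ρ = pair (⟦ a ⟧ ρ) (⟦ b ⟧ ρ)
    ⟦ if0 c then a else b ⟧  ρ = ifZero (⟦ c ⟧ ρ) (⟦ a ⟧ ρ) (⟦ b ⟧ ρ)
    ⟦ rec b s c ⟧            ρ = ⟦rec⟧ b s ρ (⟦ c ⟧ ρ)
    ⟦ app f as ⟧             ρ = ⟦ f ⟧ (⟦ as ⟧* ρ)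

    ⟦_⟧* : ∀ {n m} → Vec (Expr n) m → Vec ℕ n → Vec ℕ m
    ⟦ [] ⟧*     ρ = []
    ⟦ a ∷ as ⟧* ρ = ⟦ a ⟧ ρ ∷ ⟦ as ⟧* ρ

    ⟦rec⟧ : ∀ {n} → Expr n → Expr (suc (suc n)) → Vec ℕ n → ℕ → ℕ
    ⟦rec⟧ b s ρ zero    = ⟦ b ⟧ ρ
    ⟦rec⟧ b s ρ (suc k) = ⟦ s ⟧ (k ∷ ⟦rec⟧ b s ρ k ∷ ρ)

  encodeEnv : ∀ {n} → Vec ℕ n → ℕ
  encodeEnv []      = 0
  encodeEnv (x ∷ ρ) = pair x (encodeEnv ρ)

  private
    identity predecessor : Code
    identity    = cPair cFst cSnd
    predecessor = cRec cZero (cComp cFst cSnd)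

    constant : ℕ → Code
    constant zero    = cZero
    constant (suc k) = cComp cSucc (constant k)

    -- ⟨a , ⟨k , h⟩⟩ ↦ ⟨k , ⟨h , a⟩⟩: the environment seen by the step of rec
    stepEnv : Code
    stepEnv = cPair (cComp cFst cSnd) (cPair (cComp cSnd cSnd) cFst)

    identity-correct : ∀ x → identity ⊢ x ⇓ x
    identity-correct x = ⇓-respʳ-≡ (ev-pair ev-fst ev-snd) (pair-fst-snd x)

    constant-correct : ∀ k x → constant k ⊢ x ⇓ k
    constant-correct zero    x = ev-zero
    constant-correct (suc k) x = ev-comp (constant-correct k x) ev-succ

    predecessor-correct : ∀ m → predecessor ⊢ pair 0 m ⇓ pred m
    predecessor-correct m = ev-rec-pair (go m)
      where
      go : ∀ m → Rec cZero (cComp cFst cSnd) 0 m (pred m)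
      go zero    = rec-zero ev-zero
      go (suc k) = rec-suc (go k) (ev-comp (ev-snd-pair {0} {pair k (pred k)}) ev-fst-pair)

  mutual
    compile : ∀ {n} → Expr n → Code
    compile (var zero)             = cFst
    compile (var (suc i))          = cComp (compile (var i)) cSnd
    compile (lit k)                = constant k
    compile (succ e)               = cComp cSucc (compile e)
    compile (dec e)                = cComp predecessor (cPair cZero (compile e))
    compile (π₁ e)                 = cComp cFst (compile e)
    compile (π₂ e)                 = cComp cSnd (compile e)
    compile ⟨ a , b ⟩              = cPair (compile a) (compile b)
    compile (if0 c then a else b)  =
      cComp (cRec (compile a) (cComp (compile b) cFst)) (cPair identity (compile c))
    compile (rec b s c)            =
      cComp (cRec (compile b) (cComp (compile s) stepEnv)) (cPair identity (compile c))
    compile (app f as)             = cComp (compile f) (compile* as)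

    compile* : ∀ {n m} → Vec (Expr n) m → Code
    compile* []       = cZero
    compile* (a ∷ as) = cPair (compile a) (compile* as)

  mutual
    compile-correct : ∀ {n} (e : Expr n) ρ → compile e ⊢ encodeEnv ρ ⇓ ⟦ e ⟧ ρ
    compile-correct (var zero)    (x ∷ ρ) = ev-fst-pair {x} {encodeEnv ρ}
    compile-correct (var (suc i)) (x ∷ ρ) =
      ev-comp (ev-snd-pair {x} {encodeEnv ρ}) (compile-correct (var i) ρ)
    compile-correct (lit k)       ρ = constant-correct k _
    compile-correct (succ e)      ρ = ev-comp (compile-correct e ρ) ev-succ
    compile-correct (dec e)       ρ =
      ev-comp (ev-pair ev-zero (compile-correct e ρ)) (predecessor-correct (⟦ e ⟧ ρ))
    compile-correct (π₁ e)        ρ = ev-comp (compile-correct e ρ) ev-fst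
    compile-correct (π₂ e)        ρ = ev-comp (compile-correct e ρ) ev-snd
    compile-correct ⟨ a , b ⟩     ρ = ev-pair (compile-correct a ρ) (compile-correct b ρ)
    compile-correct (if0 c then a else b) ρ =
      ev-comp (ev-pair (identity-correct _) (compile-correct c ρ)) (ev-rec-pair (go (⟦ c ⟧ ρ)))
      where
      go : ∀ m → Rec (compile a) (cComp (compile b) cFst) (encodeEnv ρ) m (ifZero m (⟦ a ⟧ ρ) (⟦ b ⟧ ρ))
      go zero    = rec-zero (compile-correct a ρ)
      go (suc k) = rec-suc (go k) (ev-comp (ev-fst-pair {encodeEnv ρ} {pair k _}) (compile-correct b ρ))
    compile-correct (rec b s c)   ρ =
      ev-comp (ev-pair (identity-correct _) (compile-correct c ρ)) (ev-rec-pair (go (⟦ c ⟧ ρ)))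
      where
      go : ∀ m → Rec (compile b) (cComp (compile s) stepEnv) (encodeEnv ρ) m (⟦rec⟧ b s ρ m)
      go zero    = rec-zero (compile-correct b ρ)
      go (suc k) = rec-suc (go k) (ev-comp {y = encodeEnv (k ∷ h ∷ ρ)} stepEnv-correct (compile-correct s (k ∷ h ∷ ρ)))
        where
        h = ⟦rec⟧ b s ρ k
        stepEnv-correct : stepEnv ⊢ pair (encodeEnv ρ) (pair k h) ⇓ pair k (pair h (encodeEnv ρ))
        stepEnv-correct =
          ev-pair (ev-comp (ev-snd-pair {encodeEnv ρ} {pair k h}) (ev-fst-pair {k} {h}))
                  (ev-pair (ev-comp (ev-snd-pair {encodeEnv ρ} {pair k h}) (ev-snd-pair {k} {h}))
                           (ev-fst-pair {encodeEnv ρ} {pair k h}))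
    compile-correct (app f as)    ρ = ev-comp (compile*-correct as ρ) (compile-correct f (⟦ as ⟧* ρ))

    compile*-correct : ∀ {n m} (as : Vec (Expr n) m) ρ → compile* as ⊢ encodeEnv ρ ⇓ encodeEnv (⟦ as ⟧* ρ)
    compile*-correct []       ρ = ev-zero
    compile*-correct (a ∷ as) ρ = ev-pair (compile-correct a ρ) (compile*-correct as ρ)

  program : Expr 1 → Code
  program e = cComp (compile e) (cPair identity cZero)

  program-correct : ∀ e x → program e ⊢ x ⇓ ⟦ e ⟧ (x ∷ [])
  program-correct e x = ev-comp (ev-pair (identity-correct x) ev-zero) (compile-correct e (x ∷ []))

module Coding where
  open import Data.Nat
  open import Data.Nat.Properties
  open import Data.Product using (_,_; uncurry)
  open import Data.List using (List; []; _∷_)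
  open import Data.List.NonEmpty using (List⁺; _∷_)
  open import Relation.Binary.PropositionalEquality
  open CantorPairing

  decodeList′-stable : ∀ k k′ n → n ≤ k → n ≤ k′ → decodeList′ k n ≡ decodeList′ k′ n
  decodeList′-stable zero    zero     zero    _       _       = refl
  decodeList′-stable zero    (suc k′) zero    _       _       = refl
  decodeList′-stable (suc k) zero     zero    _       _       = refl
  decodeList′-stable (suc k) (suc k′) zero    _       _       = refl
  decodeList′-stable (suc k) (suc k′) (suc n) (s≤s p) (s≤s q) =
    cong (fst n ∷_) (decodeList′-stable k k′ (snd n) (≤-trans (snd≤ n) p) (≤-trans (snd≤ n) q))

  decodeList-cons : ∀ a b → decodeList (suc (pair a b)) ≡ a ∷ decodeList b
  decodeList-cons a b rewrite fst-pair a b =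
    cong (a ∷_) (trans (cong (decodeList′ (pair a b)) (snd-pair a b))
                       (decodeList′-stable (pair a b) b b (n≤pair-m-n a b) ≤-refl))

  encodeList : List ℕ → ℕ
  encodeList []       = 0
  encodeList (x ∷ xs) = suc (pair x (encodeList xs))

  decodeList-encodeList : ∀ xs → decodeList (encodeList xs) ≡ xs
  decodeList-encodeList []       = refl
  decodeList-encodeList (x ∷ xs) =
    trans (decodeList-cons x (encodeList xs)) (cong (x ∷_) (decodeList-encodeList xs))

  encodeD : List⁺ ℕ → ℕ
  encodeD (x ∷ xs) = pair x (encodeList xs)

  decodeD-encodeD : ∀ w → decodeD (encodeD w) ≡ w
  decodeD-encodeD (x ∷ xs)
    rewrite fst-pair x (encodeList xs) | snd-pair x (encodeList xs) | decodeList-encodeList xs = refl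

  private
    payload< : ∀ {n t r} → unpair n ≡ (suc t , r) → r < n
    payload< {n} {t} {r} eq =
      subst (r <_) (trans (cong (uncurry pair) (sym eq)) (pair-fst-snd n)) (s≤s (m≤n+m r _))

  mutual
    decodeCode′-stable : ∀ k k′ n → n ≤ k → n ≤ k′ → decodeCode′ k n ≡ decodeCode′ k′ n
    decodeCode′-stable zero    zero     n       _ _ = refl
    decodeCode′-stable zero    (suc k′) zero    _ _ = refl
    decodeCode′-stable (suc k) zero     zero    _ _ = refl
    decodeCode′-stable (suc k) (suc k′) n       p q with unpair n in eq
    ... | 0 , r = refl
    ... | 1 , r = refl
    ... | 2 , r = refl
    ... | 3 , r = refl
    ... | 4 , r = cong₂ cPair (payload-stable k k′ p q eq (fst≤ r)) (payload-stable k k′ p q eq (snd≤ r))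
    ... | 5 , r = cong₂ cComp (payload-stable k k′ p q eq (fst≤ r)) (payload-stable k k′ p q eq (snd≤ r))
    ... | 6 , r = cong₂ cRec  (payload-stable k k′ p q eq (fst≤ r)) (payload-stable k k′ p q eq (snd≤ r))
    ... | 7 , r = cong cMu (payload-stable k k′ p q eq ≤-refl)
    ... | suc (suc (suc (suc (suc (suc (suc (suc _))))))) , r = refl

    payload-stable : ∀ k k′ {n t r m} → n ≤ suc k → n ≤ suc k′ → unpair n ≡ (suc t , r) → m ≤ r →
                     decodeCode′ k m ≡ decodeCode′ k′ m
    payload-stable k k′ {n} {m = m} p q eq m≤r = decodeCode′-stable k k′ m (below p) (below q)
      where
      below : ∀ {j} → n ≤ suc j → m ≤ j
      below n≤1+j = ≤-pred (≤-trans (s≤s m≤r) (≤-trans (payload< eq) n≤1+j))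

  private
    decodeCode-payload : ∀ t r {x} → x ≤ r → decodeCode′ (pred (pair (suc t) r)) x ≡ decodeCode x
    decodeCode-payload t r {x} x≤r =
      decodeCode′-stable _ x x (≤-trans x≤r (m≤n+m r (t + r + tri (t + r)))) ≤-refl

  ⌜cPair⌝ ⌜cComp⌝ ⌜cRec⌝ : ℕ → ℕ → ℕ
  ⌜cPair⌝ a b = pair 4 (pair a b)
  ⌜cComp⌝ a b = pair 5 (pair a b)
  ⌜cRec⌝  a b = pair 6 (pair a b)

  ⌜cMu⌝ : ℕ → ℕ
  ⌜cMu⌝ a = pair 7 a

  decodeCode-⌜cPair⌝ : ∀ a b → decodeCode (⌜cPair⌝ a b) ≡ cPair (decodeCode a) (decodeCode b)
  decodeCode-⌜cPair⌝ a b rewrite unpair-pair 4 (pair a b) | fst-pair a b | snd-pair a b =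
    cong₂ cPair (decodeCode-payload 3 (pair a b) (m≤pair-m-n a b)) (decodeCode-payload 3 (pair a b) (n≤pair-m-n a b))

  decodeCode-⌜cComp⌝ : ∀ a b → decodeCode (⌜cComp⌝ a b) ≡ cComp (decodeCode a) (decodeCode b)
  decodeCode-⌜cComp⌝ a b rewrite unpair-pair 5 (pair a b) | fst-pair a b | snd-pair a b =
    cong₂ cComp (decodeCode-payload 4 (pair a b) (m≤pair-m-n a b)) (decodeCode-payload 4 (pair a b) (n≤pair-m-n a b))

  decodeCode-⌜cRec⌝ : ∀ a b → decodeCode (⌜cRec⌝ a b) ≡ cRec (decodeCode a) (decodeCode b)
  decodeCode-⌜cRec⌝ a b rewrite unpair-pair 6 (pair a b) | fst-pair a b | snd-pair a b =
    cong₂ cRec (decodeCode-payload 5 (pair a b) (m≤pair-m-n a b)) (decodeCode-payload 5 (pair a b) (n≤pair-m-n a b))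

  decodeCode-⌜cMu⌝ : ∀ a → decodeCode (⌜cMu⌝ a) ≡ cMu (decodeCode a)
  decodeCode-⌜cMu⌝ a rewrite unpair-pair 7 a = cong cMu (decodeCode-payload 6 a ≤-refl)

  -- Opaque, so that the type checker never unfolds the (huge) Gödel numbers of concrete programs.
  opaque
    encodeCode : Code → ℕ
    encodeCode cZero       = pair 0 0
    encodeCode cSucc       = pair 1 0
    encodeCode cFst        = pair 2 0
    encodeCode cSnd        = pair 3 0
    encodeCode (cPair f g) = ⌜cPair⌝ (encodeCode f) (encodeCode g)
    encodeCode (cComp f g) = ⌜cComp⌝ (encodeCode f) (encodeCode g)
    encodeCode (cRec f g)  = ⌜cRec⌝ (encodeCode f) (encodeCode g)
    encodeCode (cMu f)     = ⌜cMu⌝ (encodeCode f)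

    decodeCode-encodeCode : ∀ c → decodeCode (encodeCode c) ≡ c
    decodeCode-encodeCode cZero       = refl
    decodeCode-encodeCode cSucc       = refl
    decodeCode-encodeCode cFst        = refl
    decodeCode-encodeCode cSnd        = refl
    decodeCode-encodeCode (cPair f g) =
      trans (decodeCode-⌜cPair⌝ (encodeCode f) (encodeCode g))
            (cong₂ cPair (decodeCode-encodeCode f) (decodeCode-encodeCode g))
    decodeCode-encodeCode (cComp f g) =
      trans (decodeCode-⌜cComp⌝ (encodeCode f) (encodeCode g))
            (cong₂ cComp (decodeCode-encodeCode f) (decodeCode-encodeCode g))
    decodeCode-encodeCode (cRec f g)  =
      trans (decodeCode-⌜cRec⌝ (encodeCode f) (encodeCode g))
            (cong₂ cRec (decodeCode-encodeCode f) (decodeCode-encodeCode g))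
    decodeCode-encodeCode (cMu f)     = trans (decodeCode-⌜cMu⌝ (encodeCode f)) (cong cMu (decodeCode-encodeCode f))

  Φ-encodeCode : ∀ c {x y} → c ⊢ x ⇓ y → Φ (encodeCode c) x y
  Φ-encodeCode c {x} {y} = subst (λ c′ → c′ ⊢ x ⇓ y) (sym (decodeCode-encodeCode c))

  Φ-encodeCode⁻¹ : ∀ c {x y} → Φ (encodeCode c) x y → c ⊢ x ⇓ y
  Φ-encodeCode⁻¹ c {x} {y} = subst (λ c′ → c′ ⊢ x ⇓ y) (decodeCode-encodeCode c)

module BasicPrograms where
  open import Data.Nat using (ℕ; zero; suc; pred; _+_)
  open import Data.Nat.Properties using (+-identityʳ; +-suc)
  open import Data.Vec using ([]; _∷_)
  open import Data.List using (foldl)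
  open import Relation.Binary.PropositionalEquality
  open CantorPairing
  open Expressions

  infixl 6 _+ₑ_

  _+ₑ_ : ∀ {n} → Expr n → Expr n → Expr n
  a +ₑ b = rec a (succ x₁) b

  ⟦+ₑ⟧ : ∀ {n} (a b : Expr n) ρ → ⟦ a +ₑ b ⟧ ρ ≡ ⟦ a ⟧ ρ + ⟦ b ⟧ ρ
  ⟦+ₑ⟧ a b ρ = go (⟦ b ⟧ ρ)
    where
    go : ∀ k → ⟦rec⟧ a (succ x₁) ρ k ≡ ⟦ a ⟧ ρ + k
    go zero    = sym (+-identityʳ _)
    go (suc k) = trans (cong suc (go k)) (sym (+-suc _ k))

  parity : ℕ → ℕ
  parity zero    = 0
  parity (suc n) = ifZero (parity n) 1 0

  half : ℕ → ℕ
  half zero    = 0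
  half (suc n) = half n + parity n

  parityE halfE : ∀ {n} → Expr n → Expr n
  parityE = rec (lit 0) (if0 x₁ then lit 1 else lit 0)
  halfE   = rec (lit 0) (x₁ +ₑ parityE x₀)

  ⟦parityE⟧ : ∀ {n} (e : Expr n) ρ → ⟦ parityE e ⟧ ρ ≡ parity (⟦ e ⟧ ρ)
  ⟦parityE⟧ e ρ = go (⟦ e ⟧ ρ)
    where
    go : ∀ k → ⟦rec⟧ (lit 0) (if0 x₁ then lit 1 else lit 0) ρ k ≡ parity k
    go zero    = refl
    go (suc k) = cong (λ p → ifZero p 1 0) (go k)

  ⟦halfE⟧ : ∀ {n} (e : Expr n) ρ → ⟦ halfE e ⟧ ρ ≡ half (⟦ e ⟧ ρ)
  ⟦halfE⟧ e ρ = go (⟦ e ⟧ ρ)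
    where
    go : ∀ k → ⟦rec⟧ (lit 0) (x₁ +ₑ parityE x₀) ρ k ≡ half k
    go zero    = refl
    go (suc k) = trans (⟦+ₑ⟧ x₁ (parityE x₀) env) (cong₂ _+_ (go k) (⟦parityE⟧ x₀ env))
      where env = k ∷ ⟦rec⟧ (lit 0) (x₁ +ₑ parityE x₀) ρ k ∷ ρ

  -- foldlE st l a runs the loop state ⟨ rest of the list , accumulator ⟩ for l rounds, which is enough.
  foldlE : ∀ {n} → Expr 2 → Expr n → Expr n → Expr n
  foldlE st l a = π₂ (rec ⟨ l , a ⟩ loop l)
    where
    loop : ∀ {n} → Expr (suc (suc n))
    loop = if0 π₁ x₁ then x₁ else ⟨ π₂ (dec (π₁ x₁)) , app st (π₁ (dec (π₁ x₁)) ∷ π₂ x₁ ∷ []) ⟩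

  module _ (st : Expr 2) where
    step : ℕ → ℕ → ℕ
    step acc x = ⟦ st ⟧ (x ∷ acc ∷ [])

    ⟦foldlE⟧ : ∀ {n} (l a : Expr n) ρ → ⟦ foldlE st l a ⟧ ρ ≡ foldl step (⟦ a ⟧ ρ) (decodeList (⟦ l ⟧ ρ))
    ⟦foldlE⟧ l a ρ = trans (cong snd (rounds (⟦ l ⟧ ρ))) (iterate-foldl (⟦ l ⟧ ρ) (⟦ l ⟧ ρ) (⟦ a ⟧ ρ))
      where
      round : ℕ → ℕ
      round s = ifZero (fst s) s (pair (snd (pred (fst s))) (step (snd s) (fst (pred (fst s)))))

      iterate : ℕ → ℕ → ℕ
      iterate zero    s = s
      iterate (suc k) s = round (iterate k s)

      rounds : ∀ k → ⟦rec⟧ ⟨ l , a ⟩ _ ρ k ≡ iterate k (pair (⟦ l ⟧ ρ) (⟦ a ⟧ ρ))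
      rounds zero    = refl
      rounds (suc k) = cong round (rounds k)

      iterate-suc : ∀ k s → iterate (suc k) s ≡ iterate k (round s)
      iterate-suc zero    s = refl
      iterate-suc (suc k) s = cong round (iterate-suc k s)

      iterate-fixed : ∀ k s → round s ≡ s → iterate k s ≡ s
      iterate-fixed zero    s _  = refl
      iterate-fixed (suc k) s eq = trans (cong round (iterate-fixed k s eq)) eq

      iterate-foldl : ∀ k r acc → snd (iterate k (pair r acc)) ≡ foldl step acc (decodeList′ k r)
      iterate-foldl zero    r       acc = snd-pair r acc
      iterate-foldl (suc k) zero    acc = trans (cong snd (iterate-fixed (suc k) (pair 0 acc) done)) (snd-pair 0 acc)
        where
        done : round (pair 0 acc) ≡ pair 0 acc
        done rewrite fst-pair 0 acc = refl
      iterate-foldl (suc k) (suc m) acc = begin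
        snd (iterate (suc k) (pair (suc m) acc))      ≡⟨ cong snd (iterate-suc k _) ⟩
        snd (iterate k (round (pair (suc m) acc)))    ≡⟨ cong (λ s → snd (iterate k s)) consumed ⟩
        snd (iterate k (pair (snd m) (step acc (fst m)))) ≡⟨ iterate-foldl k (snd m) (step acc (fst m)) ⟩
        foldl step (step acc (fst m)) (decodeList′ k (snd m)) ∎
        where
        open ≡-Reasoning
        consumed : round (pair (suc m) acc) ≡ pair (snd m) (step acc (fst m))
        consumed rewrite fst-pair (suc m) acc | snd-pair (suc m) acc = refl

module LetterCoding where
  open import Data.Nat using (ℕ; zero; suc; _+_; _*_; _%_; _/_; _<_; s≤s; z≤n)
  open import Data.Nat.Properties using (+-suc; +-identityʳ; +-comm; *-comm)
  open import Data.Nat.DivMod using (m*n%n≡0; m*n/n≡m; [m+kn]%n≡m%n; +-distrib-/)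
  open import Data.Product using (Σ; _,_)
  open import Data.List using ([]; _∷_; map)
  open import Relation.Binary.PropositionalEquality
  open BasicPrograms using (parity; half)

  ⌜_⌝ : Letter → ℕ
  ⌜ gen i ⌝ = i + i
  ⌜ inv i ⌝ = suc (i + i)

  letterCode : ∀ n → Σ Letter λ x → ⌜ x ⌝ ≡ n
  letterCode zero = gen 0 , refl
  letterCode (suc n) with letterCode n
  ... | gen i , refl = inv i , refl
  ... | inv i , refl = gen (suc i) , cong suc (+-suc i i)

  private
    i+i≡i*2 : ∀ i → i + i ≡ i * 2
    i+i≡i*2 i = trans (cong (i +_) (sym (+-identityʳ i))) (*-comm 2 i)

    [1+i*2]/2≡i : ∀ i → (1 + i * 2) / 2 ≡ i
    [1+i*2]/2≡i i =
      trans (+-distrib-/ 1 (i * 2) (subst (λ r → 1 + r < 2) (sym (m*n%n≡0 i 2)) (s≤s (s≤s z≤n))))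
            (m*n/n≡m i 2)

    i*2%2≡0 : ∀ i → i * 2 % 2 ≡ 0
    i*2%2≡0 i = m*n%n≡0 i 2

    i*2/2≡i : ∀ i → i * 2 / 2 ≡ i
    i*2/2≡i i = m*n/n≡m i 2

    [1+i*2]%2≡1 : ∀ i → (1 + i * 2) % 2 ≡ 1
    [1+i*2]%2≡1 i = [m+kn]%n≡m%n 1 i 2

  decodeLetter-⌜⌝ : ∀ x → decodeLetter ⌜ x ⌝ ≡ x
  decodeLetter-⌜⌝ (gen i) rewrite i+i≡i*2 i | i*2%2≡0 i | i*2/2≡i i = refl
  decodeLetter-⌜⌝ (inv i) rewrite i+i≡i*2 i | [1+i*2]%2≡1 i | [1+i*2]/2≡i i = refl

  parity-⌜gen⌝ : ∀ i → parity ⌜ gen i ⌝ ≡ 0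
  parity-⌜gen⌝ zero    = refl
  parity-⌜gen⌝ (suc i) rewrite +-suc i i | parity-⌜gen⌝ i = refl

  parity-⌜inv⌝ : ∀ i → parity ⌜ inv i ⌝ ≡ 1
  parity-⌜inv⌝ i rewrite parity-⌜gen⌝ i = refl

  mapL≡map-decodeLetter : ∀ ns → mapL ns ≡ map decodeLetter ns
  mapL≡map-decodeLetter []       = refl
  mapL≡map-decodeLetter (n ∷ ns) = cong (decodeLetter n ∷_) (mapL≡map-decodeLetter ns)

  mutual
    half-⌜gen⌝ : ∀ i → half ⌜ gen i ⌝ ≡ i
    half-⌜gen⌝ zero    = refl
    half-⌜gen⌝ (suc i) rewrite +-suc i i | parity-⌜inv⌝ i | half-⌜inv⌝ i = +-comm i 1

    half-⌜inv⌝ : ∀ i → half ⌜ inv i ⌝ ≡ i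
    half-⌜inv⌝ i rewrite parity-⌜gen⌝ i | half-⌜gen⌝ i = +-identityʳ i

-- run f t x is 0 if f has not halted on x within clock t, and suc y once it has, with output y.
module ClockedEvaluation where
  open import Data.Nat
  open import Data.Nat.Properties
  open import Data.Vec using ([]; _∷_)
  open import Data.Product using (Σ; _×_; _,_; proj₁; proj₂)
  open import Data.Sum using (_⊎_; inj₁; inj₂)
  open import Relation.Binary.PropositionalEquality
  open CantorPairing
  open Expressions

  andThen : ℕ → (ℕ → ℕ) → ℕ
  andThen zero    k = 0
  andThen (suc y) k = k y

  -- The state of the search for a zero of f ⟨x , -⟩ after m candidates: 0 if some candidate has not
  -- halted within the clock, 1 if all gave a positive answer, 2 + n if n is the least zero.
  searchStep : ℕ → ℕ → ℕ → ℕ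
  searchStep zero                m r             = 0
  searchStep (suc zero)          m zero          = 0
  searchStep (suc zero)          m (suc zero)    = suc (suc m)
  searchStep (suc zero)          m (suc (suc _)) = 1
  searchStep (suc (suc n))       m r             = suc (suc n)

  searchResult : ℕ → ℕ
  searchResult (suc (suc n)) = suc n
  searchResult _             = 0

  mutual
    run : Code → ℕ → ℕ → ℕ
    run cZero       t x = 1
    run cSucc       t x = suc (suc x)
    run cFst        t x = suc (fst x)
    run cSnd        t x = suc (snd x)
    run (cPair f g) t x = andThen (run f t x) λ a → andThen (run g t x) λ b → suc (pair a b)
    run (cComp f g) t x = andThen (run g t x) (run f t)
    run (cRec f g)  t x = runRec f g t (fst x) (snd x)
    run (cMu f)     t x = searchResult (runSearch f t x t)

    runRec : Code → Code → ℕ → ℕ → ℕ → ℕ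
    runRec f g t a zero    = run f t a
    runRec f g t a (suc n) = andThen (runRec f g t a n) λ y → run g t (pair a (pair n y))

    runSearch : Code → ℕ → ℕ → ℕ → ℕ
    runSearch f t x zero    = 1
    runSearch f t x (suc m) = searchStep (runSearch f t x m) m (run f t (pair x m))

  mutual
    runE : Code → Expr 2
    runE cZero       = lit 1
    runE cSucc       = succ (succ x₀)
    runE cFst        = succ (π₁ x₀)
    runE cSnd        = succ (π₂ x₀)
    runE (cPair f g) =
      if0 runE f then lit 0 else if0 runE g then lit 0 else succ ⟨ dec (runE f) , dec (runE g) ⟩
    runE (cComp f g) = if0 runE g then lit 0 else app (runE f) (dec (runE g) ∷ x₁ ∷ [])
    runE (cRec f g)  = rec (app (runE f) (π₁ x₀ ∷ x₁ ∷ [])) (runRecStepE g) (π₂ x₀)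
    runE (cMu f)     = if0 search then lit 0 else if0 dec search then lit 0 else dec search
      where
      search : Expr 2
      search = rec (lit 1) (runSearchStepE f) x₁

    runRecStepE : Code → Expr 4
    runRecStepE g = if0 x₁ then lit 0 else app (runE g) (⟨ π₁ x₂ , ⟨ x₀ , dec x₁ ⟩ ⟩ ∷ x₃ ∷ [])

    runSearchStepE : Code → Expr 4
    runSearchStepE f = if0 x₁ then lit 0 else if0 dec x₁ then candidate else x₁
      where
      candidate : Expr 4
      candidate = let r = app (runE f) (⟨ x₂ , x₀ ⟩ ∷ x₃ ∷ []) in
                  if0 r then lit 0 else if0 dec r then succ (succ x₀) else lit 1

  private
    andThen-if0 : ∀ c (k : ℕ → ℕ) → ifZero c 0 (k (pred c)) ≡ andThen c k
    andThen-if0 zero    k = refl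
    andThen-if0 (suc c) k = refl

    searchStep-if0 : ∀ s m r →
      ifZero s 0 (ifZero (pred s) (ifZero r 0 (ifZero (pred r) (suc (suc m)) 1)) s) ≡ searchStep s m r
    searchStep-if0 zero                m r             = refl
    searchStep-if0 (suc zero)          m zero          = refl
    searchStep-if0 (suc zero)          m (suc zero)    = refl
    searchStep-if0 (suc zero)          m (suc (suc r)) = refl
    searchStep-if0 (suc (suc s))       m r             = refl

    searchResult-if0 : ∀ s → ifZero s 0 (ifZero (pred s) 0 (pred s)) ≡ searchResult s
    searchResult-if0 zero          = refl
    searchResult-if0 (suc zero)    = refl
    searchResult-if0 (suc (suc s)) = refl

  ⟦runE⟧ : ∀ f x t → ⟦ runE f ⟧ (x ∷ t ∷ []) ≡ run f t x
  ⟦runE⟧ cZero       x t = refl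
  ⟦runE⟧ cSucc       x t = refl
  ⟦runE⟧ cFst        x t = refl
  ⟦runE⟧ cSnd        x t = refl
  ⟦runE⟧ (cPair f g) x t rewrite ⟦runE⟧ f x t | ⟦runE⟧ g x t =
    trans (cong (ifZero (run f t x) 0) (andThen-if0 (run g t x) λ b → suc (pair (pred (run f t x)) b)))
          (andThen-if0 (run f t x) λ a → andThen (run g t x) λ b → suc (pair a b))
  ⟦runE⟧ (cComp f g) x t rewrite ⟦runE⟧ g x t =
    trans (cong (ifZero (run g t x) 0) (⟦runE⟧ f (pred (run g t x)) t)) (andThen-if0 (run g t x) (run f t))
  ⟦runE⟧ (cRec f g)  x t = go (snd x)
    where
    go : ∀ n → ⟦rec⟧ (app (runE f) (π₁ x₀ ∷ x₁ ∷ [])) (runRecStepE g) (x ∷ t ∷ []) n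
               ≡ runRec f g t (fst x) n
    go zero    = ⟦runE⟧ f (fst x) t
    go (suc n) rewrite go n =
      trans (cong (ifZero (runRec f g t (fst x) n) 0) (⟦runE⟧ g (pair (fst x) (pair n (pred y))) t))
            (andThen-if0 y λ y → run g t (pair (fst x) (pair n y)))
      where y = runRec f g t (fst x) n
  ⟦runE⟧ (cMu f)     x t =
    trans (cong (λ s → ifZero s 0 (ifZero (pred s) 0 (pred s))) (go t)) (searchResult-if0 (runSearch f t x t))
    where
    go : ∀ m → ⟦rec⟧ (lit 1) (runSearchStepE f) (x ∷ t ∷ []) m ≡ runSearch f t x m
    go zero    = refl
    go (suc m) rewrite go m | ⟦runE⟧ f (pair x m) t = searchStep-if0 (runSearch f t x m) m (run f t (pair x m))

  mutual
    run-sound : ∀ f t x y → run f t x ≡ suc y → f ⊢ x ⇓ y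
    run-sound cZero t x .0       refl = ev-zero
    run-sound cSucc t x .(suc x) refl = ev-succ
    run-sound cFst  t x .(fst x) refl = ev-fst
    run-sound cSnd  t x .(snd x) refl = ev-snd
    run-sound (cPair f g) t x y eq with run f t x in eqf | run g t x in eqg
    run-sound (cPair f g) t x y () | zero  | _
    run-sound (cPair f g) t x y () | suc a | zero
    run-sound (cPair f g) t x .(pair a b) refl | suc a | suc b =
      ev-pair (run-sound f t x a eqf) (run-sound g t x b eqg)
    run-sound (cComp f g) t x y eq with run g t x in eqg
    run-sound (cComp f g) t x y () | zero
    run-sound (cComp f g) t x y eq | suc z = ev-comp (run-sound g t x z eqg) (run-sound f t z y eq)
    run-sound (cRec f g)  t x y eq = ev-rec (runRec-sound f g t (fst x) (snd x) y eq)
    run-sound (cMu f)     t x y eq with runSearch f t x t in eqs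
    run-sound (cMu f) t x y () | zero
    run-sound (cMu f) t x y () | suc zero
    run-sound (cMu f) t x .n refl | suc (suc n) =
      ev-mu (proj₁ (runSearch-found f t x t n eqs)) (proj₂ (runSearch-found f t x t n eqs))

    runRec-sound : ∀ f g t a n y → runRec f g t a n ≡ suc y → Rec f g a n y
    runRec-sound f g t a zero    y eq = rec-zero (run-sound f t a y eq)
    runRec-sound f g t a (suc n) y eq with runRec f g t a n in eqr
    runRec-sound f g t a (suc n) y () | zero
    runRec-sound f g t a (suc n) y eq | suc z =
      rec-suc (runRec-sound f g t a n z eqr) (run-sound g t (pair a (pair n z)) y eq)

    runSearch-found : ∀ f t x m n → runSearch f t x m ≡ suc (suc n) →
                      f ⊢ pair x n ⇓ 0 × (∀ k → k < n → Σ ℕ λ j → f ⊢ pair x k ⇓ suc j)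
    runSearch-found f t x zero    n ()
    runSearch-found f t x (suc m) n eq with runSearch f t x m in eqs | run f t (pair x m) in eqr
    runSearch-found f t x (suc m) n  () | zero      | _
    runSearch-found f t x (suc m) n  () | suc zero  | zero
    runSearch-found f t x (suc m) .m refl | suc zero | suc zero =
      run-sound f t (pair x m) 0 eqr , runSearch-searching f t x m eqs
    runSearch-found f t x (suc m) n  () | suc zero  | suc (suc _)
    runSearch-found f t x (suc m) .s refl | suc (suc s) | _ = runSearch-found f t x m s eqs

    runSearch-searching : ∀ f t x m → runSearch f t x m ≡ 1 →
                          ∀ k → k < m → Σ ℕ λ j → f ⊢ pair x k ⇓ suc j
    runSearch-searching f t x zero    eq k ()
    runSearch-searching f t x (suc m) eq k k<1+m with runSearch f t x m in eqs | run f t (pair x m) in eqr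
    runSearch-searching f t x (suc m) () k k<1+m | zero     | _
    runSearch-searching f t x (suc m) () k k<1+m | suc zero | zero
    runSearch-searching f t x (suc m) () k k<1+m | suc zero | suc zero
    runSearch-searching f t x (suc m) eq k k<1+m | suc zero | suc (suc j) with m<1+n⇒m<n∨m≡n k<1+m
    ... | inj₁ k<m  = runSearch-searching f t x m eqs k k<m
    ... | inj₂ refl = j , run-sound f t (pair x m) (suc j) eqr
    runSearch-searching f t x (suc m) () k k<1+m | suc (suc s) | _

  Eventually : (ℕ → Set) → Set
  Eventually P = Σ ℕ λ t₀ → ∀ t → t₀ ≤ t → P t

  private
    eventually-× : ∀ {P Q : ℕ → Set} → Eventually P → Eventually Q → Eventually (λ t → P t × Q t)
    eventually-× (a , p) (b , q) = a ⊔ b , λ t le → p t (≤-trans (m≤m⊔n a b) le) , q t (≤-trans (m≤n⊔m a b) le)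

    eventually-∀< : ∀ n (P : ℕ → ℕ → Set) → (∀ m → m < n → Eventually (P m)) →
                    Eventually (λ t → ∀ m → m < n → P m t)
    eventually-∀< zero    P h = 0 , λ _ _ _ ()
    eventually-∀< (suc n) P h with eventually-× (eventually-∀< n P λ m m<n → h m (m<n⇒m<1+n m<n)) (h n ≤-refl)
    ... | t₀ , q = t₀ , λ t le m m<1+n → below-or-equal t le (m<1+n⇒m<n∨m≡n m<1+n)
      where
      below-or-equal : ∀ {m} t → t₀ ≤ t → m < n ⊎ m ≡ n → P m t
      below-or-equal t le (inj₁ m<n) = proj₁ (q t le) _ m<n
      below-or-equal t le (inj₂ refl) = proj₂ (q t le)

    andThen-suc : ∀ {u y} (k : ℕ → ℕ) → u ≡ suc y → andThen u k ≡ k y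
    andThen-suc k refl = refl

  module _ (f : Code) (x n t : ℕ) (n<t : n < t) (zero-at-n : run f t (pair x n) ≡ 1)
           (positive-below-n : ∀ m → m < n → Σ ℕ λ j → run f t (pair x m) ≡ suc (suc j)) where
    private
      searching : ∀ m → m ≤ n → runSearch f t x m ≡ 1
      searching zero    _   = refl
      searching (suc m) m<n rewrite searching m (≤-trans (n≤1+n m) m<n) | proj₂ (positive-below-n m m<n) = refl

      stays-found : ∀ j → runSearch f t x (j + suc n) ≡ suc (suc n)
      stays-found zero    rewrite searching n ≤-refl | zero-at-n = refl
      stays-found (suc j) rewrite stays-found j = refl

    run-search-finds : run (cMu f) t x ≡ suc n
    run-search-finds =
      trans (cong (λ m → searchResult (runSearch f t x m)) (sym (m∸n+n≡m n<t)))
            (cong searchResult (stays-found (t ∸ suc n)))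

  mutual
    run-complete : ∀ {f x y} → f ⊢ x ⇓ y → Eventually (λ t → run f t x ≡ suc y)
    run-complete ev-zero = 0 , λ _ _ → refl
    run-complete ev-succ = 0 , λ _ _ → refl
    run-complete ev-fst  = 0 , λ _ _ → refl
    run-complete ev-snd  = 0 , λ _ _ → refl
    run-complete (ev-pair d₁ d₂) with eventually-× (run-complete d₁) (run-complete d₂)
    ... | t₀ , q = t₀ , λ t le → andThen-pair (proj₁ (q t le)) (proj₂ (q t le))
      where
      andThen-pair : ∀ {u v a b} → u ≡ suc a → v ≡ suc b →
                     andThen u (λ a → andThen v λ b → suc (pair a b)) ≡ suc (pair a b)
      andThen-pair refl refl = refl
    run-complete (ev-comp {f} d₁ d₂) with eventually-× (run-complete d₁) (run-complete d₂)
    ... | t₀ , q = t₀ , λ t le → trans (andThen-suc (run f t) (proj₁ (q t le))) (proj₂ (q t le))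
    run-complete (ev-rec r) = runRec-complete r
    run-complete (ev-mu {f} {x} {n} d h)
      with eventually-× (eventually-∀< n (λ m t → Σ ℕ λ j → run f t (pair x m) ≡ suc (suc j)) positive)
                        (run-complete d)
      where
      positive : ∀ m → m < n → Eventually (λ t → Σ ℕ λ j → run f t (pair x m) ≡ suc (suc j))
      positive m m<n with h m m<n
      ... | j , dj with run-complete dj
      ...   | t₀ , p = t₀ , λ t le → j , p t le
    ... | t₀ , q = t₀ ⊔ suc n , λ t le →
      let q′ = q t (≤-trans (m≤m⊔n t₀ (suc n)) le) in
      run-search-finds f x n t (≤-trans (m≤n⊔m t₀ (suc n)) le) (proj₂ q′) (proj₁ q′)

    runRec-complete : ∀ {f g a n y} → Rec f g a n y → Eventually (λ t → runRec f g t a n ≡ suc y)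
    runRec-complete (rec-zero d) = run-complete d
    runRec-complete {g = g} {a = a} (rec-suc {n = n} r d) with eventually-× (runRec-complete r) (run-complete d)
    ... | t₀ , q = t₀ , λ t le →
      trans (andThen-suc (λ y → run g t (pair a (pair n y))) (proj₁ (q t le))) (proj₂ (q t le))

module HaltingSearch where
  open import Data.Nat
  open import Data.Nat.Properties using (≤-refl; m<1+n⇒m<n∨m≡n; 0≢1+n)
  open import Data.Vec using ([]; _∷_)
  open import Data.Product using (Σ; _×_; _,_; proj₁; proj₂)
  open import Data.Sum using (_⊎_; inj₁; inj₂)
  open import Data.Empty using (⊥-elim)
  open import Function.Bundles using (_⇔_; mk⇔)
  open import Relation.Binary.PropositionalEquality
  open CantorPairing
  open Evaluation
  open Expressions
  open ClockedEvaluation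

  Positive : ℕ → Set
  Positive n = Σ ℕ λ j → n ≡ suc j

  LeastZero : (ℕ → ℕ) → ℕ → Set
  LeastZero F m = F m ≡ 0 × (∀ k → k < m → Positive (F k))

  private
    positive-or-least-zero : ∀ F n → (∀ k → k < n → Positive (F k)) ⊎ Σ ℕ (LeastZero F)
    positive-or-least-zero F zero = inj₁ λ _ ()
    positive-or-least-zero F (suc n) with positive-or-least-zero F n
    ... | inj₂ least = inj₂ least
    ... | inj₁ below with F n in eq
    ...   | zero  = inj₂ (n , eq , below)
    ...   | suc j = inj₁ λ k k<1+n → upTo (m<1+n⇒m<n∨m≡n k<1+n)
      where
      upTo : ∀ {k} → k < n ⊎ k ≡ n → Positive (F k)
      upTo (inj₁ k<n) = below _ k<n
      upTo (inj₂ refl) = j , eq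

  least-zero : ∀ F n → F n ≡ 0 → Σ ℕ (LeastZero F)
  least-zero F n Fn≡0 with positive-or-least-zero F (suc n)
  ... | inj₂ least = least
  ... | inj₁ below with below n ≤-refl
  ...   | j , Fn≡1+j = ⊥-elim (0≢1+n (trans (sym Fn≡0) Fn≡1+j))

  -- searchHalting c F dovetails over pairs ⟨ w , clock ⟩.
  module _ (c : Code) (F : Expr 2) where
    private
      test : Expr 1
      test = if0 app (runE c) (app F (π₁ x₀ ∷ π₁ (π₂ x₀) ∷ []) ∷ π₂ (π₂ x₀) ∷ []) then lit 1 else lit 0

      testF : ℕ → ℕ → ℕ
      testF x s = ⟦ test ⟧ (pair x s ∷ [])

      ⟦test⟧ : ∀ x s → testF x s ≡ ifZero (run c (snd s) (⟦ F ⟧ (x ∷ fst s ∷ []))) 1 0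
      ⟦test⟧ x s rewrite fst-pair x s | snd-pair x s =
        cong (λ r → ifZero r 1 0) (⟦runE⟧ c (⟦ F ⟧ (x ∷ fst s ∷ [])) (snd s))

      ifZero-1-0 : ∀ r → ifZero r 1 0 ≡ 0 → Positive r
      ifZero-1-0 (suc r) _ = r , refl

    searchHalting : Code
    searchHalting = cMu (program test)

    searchHalting-halts⇔ : ∀ x → (Σ ℕ λ y → searchHalting ⊢ x ⇓ y) ⇔
                                 (Σ ℕ λ w → Σ ℕ λ y → c ⊢ ⟦ F ⟧ (x ∷ w ∷ []) ⇓ y)
    searchHalting-halts⇔ x = mk⇔ to from
      where
      to : (Σ ℕ λ y → searchHalting ⊢ x ⇓ y) → Σ ℕ λ w → Σ ℕ λ y → c ⊢ ⟦ F ⟧ (x ∷ w ∷ []) ⇓ y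
      to (s , ev-mu test≡0 _) with ifZero-1-0 _ (trans (sym (⟦test⟧ x s))
                                    (⇓-deterministic (program-correct test (pair x s)) test≡0))
      ... | v , run≡1+v = fst s , v , run-sound c (snd s) _ v run≡1+v

      from : (Σ ℕ λ w → Σ ℕ λ y → c ⊢ ⟦ F ⟧ (x ∷ w ∷ []) ⇓ y) → Σ ℕ λ y → searchHalting ⊢ x ⇓ y
      from (w , y , d) with run-complete d
      ... | t₀ , halted with least-zero (testF x) (pair w t₀) (witness (halted t₀ ≤-refl))
        where
        witness : run c t₀ (⟦ F ⟧ (x ∷ w ∷ [])) ≡ suc y → testF x (pair w t₀) ≡ 0
        witness eq rewrite ⟦test⟧ x (pair w t₀) | fst-pair w t₀ | snd-pair w t₀ | eq = refl
      ... | s , test≡0 , below =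
        s , ev-mu (⇓-respʳ-≡ (program-correct test (pair x s)) test≡0)
                  (λ k k<s → proj₁ (below k k<s) , ⇓-respʳ-≡ (program-correct test (pair x k)) (proj₂ (below k k<s)))

module GrothendieckGroup {c ℓ} (S : CommutativeSemigroup c ℓ) (s₀ : CommutativeSemigroup.Carrier S) where
  open import Level using (_⊔_)
  open import Data.Product using (_×_; _,_)
  open import Algebra.Bundles.Raw using (RawGroup)
  open import Algebra.Morphism.Structures using (module MagmaMorphisms)
  open CommutativeSemigroup S
  open import Algebra.Properties.CommutativeSemigroup S using (interchange; xy∙z≈y∙xz; xy∙z≈x∙zy; xy∙z≈z∙yx)
  open import Relation.Binary.Reasoning.Setoid setoid

  𝒢 : RawGroup c (c ⊔ ℓ)
  𝒢 = Grothendieck S s₀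

  open RawGroup 𝒢 public using () renaming (_≈_ to _≈ᴳ_; _∙_ to _·_; _⁻¹ to _⁻¹ᴳ; ε to εᴳ)

  ∼-by : ∀ {a b a′ b′} → a ∙ b′ ≈ a′ ∙ b → (a , b) ≈ᴳ (a′ , b′)
  ∼-by {a} eq = a , ∙-congʳ eq

  private
    ∼-refl : ∀ {x} → x ≈ᴳ x
    ∼-refl {a , b} = a , refl

    ∼-sym : ∀ {x y} → x ≈ᴳ y → y ≈ᴳ x
    ∼-sym (z , eq) = z , sym eq

    swap-outer : ∀ x y z w → (x ∙ y) ∙ (z ∙ w) ≈ (x ∙ w) ∙ (z ∙ y)
    swap-outer x y z w = trans (∙-congˡ (comm z w)) (trans (interchange x y w z) (∙-congˡ (comm y z)))

    ∼-trans : ∀ {x y w} → x ≈ᴳ y → y ≈ᴳ w → x ≈ᴳ w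
    ∼-trans {a , b} {c , d} {e , f} (z , p) (u , q) = (c ∙ d) ∙ (z ∙ u) , (begin
      (a ∙ f) ∙ ((c ∙ d) ∙ (z ∙ u))   ≈⟨ assoc (a ∙ f) (c ∙ d) (z ∙ u) ⟨
      ((a ∙ f) ∙ (c ∙ d)) ∙ (z ∙ u)   ≈⟨ ∙-congʳ (swap-outer a d c f) ⟨
      ((a ∙ d) ∙ (c ∙ f)) ∙ (z ∙ u)   ≈⟨ interchange (a ∙ d) (c ∙ f) z u ⟩
      ((a ∙ d) ∙ z) ∙ ((c ∙ f) ∙ u)   ≈⟨ ∙-cong p q ⟩
      ((c ∙ b) ∙ z) ∙ ((e ∙ d) ∙ u)   ≈⟨ interchange (c ∙ b) (e ∙ d) z u ⟨
      ((c ∙ b) ∙ (e ∙ d)) ∙ (z ∙ u)   ≈⟨ ∙-congʳ (trans (comm (c ∙ b) (e ∙ d)) (swap-outer e d c b)) ⟩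
      ((e ∙ b) ∙ (c ∙ d)) ∙ (z ∙ u)   ≈⟨ assoc (e ∙ b) (c ∙ d) (z ∙ u) ⟩
      (e ∙ b) ∙ ((c ∙ d) ∙ (z ∙ u))   ∎)

    ·-cong : ∀ {x y u w} → x ≈ᴳ y → u ≈ᴳ w → (x · u) ≈ᴳ (y · w)
    ·-cong {a , b} {a′ , b′} {c₁ , d} {c′ , d′} (z , p) (u , q) = z ∙ u , (begin
      ((a ∙ c₁) ∙ (b′ ∙ d′)) ∙ (z ∙ u)   ≈⟨ ∙-congʳ (interchange a c₁ b′ d′) ⟩
      ((a ∙ b′) ∙ (c₁ ∙ d′)) ∙ (z ∙ u)   ≈⟨ interchange (a ∙ b′) (c₁ ∙ d′) z u ⟩
      ((a ∙ b′) ∙ z) ∙ ((c₁ ∙ d′) ∙ u)   ≈⟨ ∙-cong p q ⟩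
      ((a′ ∙ b) ∙ z) ∙ ((c′ ∙ d) ∙ u)   ≈⟨ interchange (a′ ∙ b) (c′ ∙ d) z u ⟨
      ((a′ ∙ b) ∙ (c′ ∙ d)) ∙ (z ∙ u)   ≈⟨ ∙-congʳ (interchange a′ c′ b d) ⟨
      ((a′ ∙ c′) ∙ (b ∙ d)) ∙ (z ∙ u)   ∎)

    ⁻¹-cong : ∀ {x y} → x ≈ᴳ y → x ⁻¹ᴳ ≈ᴳ y ⁻¹ᴳ
    ⁻¹-cong {a , b} {a′ , b′} (z , p) = z , (begin
      (b ∙ a′) ∙ z   ≈⟨ ∙-congʳ (comm b a′) ⟩
      (a′ ∙ b) ∙ z   ≈⟨ p ⟨
      (a ∙ b′) ∙ z   ≈⟨ ∙-congʳ (comm a b′) ⟩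
      (b′ ∙ a) ∙ z   ∎)

  grothendieckGroup : AbelianGroup c (c ⊔ ℓ)
  grothendieckGroup = record
    { Carrier = Carrier × Carrier ; _≈_ = _≈ᴳ_ ; _∙_ = _·_ ; ε = εᴳ ; _⁻¹ = _⁻¹ᴳ
    ; isAbelianGroup = record
      { isGroup = record
        { isMonoid = record
          { isSemigroup = record
            { isMagma = record
              { isEquivalence = record { refl = ∼-refl ; sym = ∼-sym ; trans = ∼-trans }
              ; ∙-cong = ·-cong }
            ; assoc = λ where (a , b) (c , d) (e , f) → ∼-by (∙-cong (assoc a c e) (sym (assoc b d f))) }
          ; identity = (λ where (a , b) → ∼-by (xy∙z≈y∙xz s₀ a b))
                     , (λ where (a , b) → ∼-by (xy∙z≈x∙zy a s₀ b)) }
        ; inverse = (λ where (a , b) → ∼-by (xy∙z≈z∙yx b a s₀))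
                  , (λ where (a , b) → ∼-by (xy∙z≈z∙yx a b s₀))
        ; ⁻¹-cong = ⁻¹-cong }
      ; comm = λ where (a , b) (c , d) → ∼-by (∙-cong (comm a c) (comm d b)) } }

  γ-cong : ∀ {a b} → a ≈ b → γ S a ≈ᴳ γ S b
  γ-cong a≈b = ∼-by (∙-cong (∙-cong a≈b a≈b) (sym a≈b))

  γ-homo : ∀ a b → γ S (a ∙ b) ≈ᴳ γ S a · γ S b
  γ-homo a b = ∼-by (∙-congʳ (interchange a b a b))

  γ-isMagmaHomomorphism : MagmaMorphisms.IsMagmaHomomorphism rawMagma (AbelianGroup.rawMagma grothendieckGroup) (γ S)
  γ-isMagmaHomomorphism = record { isRelHomomorphism = record { cong = γ-cong } ; homo = γ-homo }

  pair≈γ-γ⁻¹ : ∀ a b → (a , b) ≈ᴳ γ S a · (γ S b) ⁻¹ᴳ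
  pair≈γ-γ⁻¹ a b = ∼-by (trans (sym (assoc a a (b ∙ b))) (sym (assoc (a ∙ a) b b)))

module WordPrograms where
  open import Data.Nat using (ℕ; suc; _+_)
  open import Data.Vec using ([]; _∷_)
  open import Data.List using ([]; _∷_; foldl)
  open import Data.Product using (_,_)
  open import Relation.Binary.PropositionalEquality
  open CantorPairing
  open Coding using (decodeList-cons)
  open Expressions
  open BasicPrograms
  open LetterCoding

  consCode : ℕ → ℕ → ℕ
  consCode k l = suc (pair k l)

  consE : ∀ {n} → Expr n → Expr n → Expr n
  consE a l = succ ⟨ a , l ⟩

  decodeF-consCode : ∀ x acc → decodeF (consCode ⌜ x ⌝ acc) ≡ x ∷ decodeF acc
  decodeF-consCode x acc =
    trans (cong mapL (decodeList-cons ⌜ x ⌝ acc)) (cong (_∷ decodeF acc) (decodeLetter-⌜⌝ x))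

  invert : Letter → Letter
  invert (gen i) = inv i
  invert (inv i) = gen i

  data Side : Set where
    positive negative : Side

  -- The letters of S contributed by a letter of F_ω to the given component of its image γ(x_i)^{±1}.
  partCode : Side → Letter → ℕ → ℕ
  partCode positive (gen i) acc = consCode i (consCode i acc)
  partCode positive (inv i) acc = consCode i acc
  partCode negative (gen i) acc = consCode i acc
  partCode negative (inv i) acc = consCode i (consCode i acc)

  sideStepE : Side → Expr 2
  sideStepE positive = consE (halfE x₀) (if0 parityE x₀ then consE (halfE x₀) x₁ else x₁)
  sideStepE negative = consE (halfE x₀) (if0 parityE x₀ then x₁ else consE (halfE x₀) x₁)

  generatorStepE inverseStepE : Expr 2
  generatorStepE = consE (x₀ +ₑ x₀) x₁
  inverseStepE   = consE (if0 parityE x₀ then succ (halfE x₀ +ₑ halfE x₀) else halfE x₀ +ₑ halfE x₀) x₁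

  private
    ⟦halfE-x₀⟧ : ∀ ℓ acc → ⟦ halfE x₀ ⟧ (ℓ ∷ acc ∷ []) ≡ half ℓ
    ⟦halfE-x₀⟧ ℓ acc = ⟦halfE⟧ x₀ (ℓ ∷ acc ∷ [])

    ⟦parityE-x₀⟧ : ∀ ℓ acc → ⟦ parityE x₀ ⟧ (ℓ ∷ acc ∷ []) ≡ parity ℓ
    ⟦parityE-x₀⟧ ℓ acc = ⟦parityE⟧ x₀ (ℓ ∷ acc ∷ [])

  step-sideStepE : ∀ s acc ℓ → step (sideStepE s) acc ℓ ≡ partCode s (decodeLetter ℓ) acc
  step-sideStepE s acc ℓ with letterCode ℓ
  ... | x , refl rewrite decodeLetter-⌜⌝ x = byLetter s x
    where
    byLetter : ∀ s x → step (sideStepE s) acc ⌜ x ⌝ ≡ partCode s x acc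
    byLetter positive x rewrite ⟦halfE-x₀⟧ ⌜ x ⌝ acc | ⟦parityE-x₀⟧ ⌜ x ⌝ acc with x
    ... | gen i rewrite half-⌜gen⌝ i | parity-⌜gen⌝ i = refl
    ... | inv i rewrite half-⌜inv⌝ i | parity-⌜inv⌝ i = refl
    byLetter negative x rewrite ⟦halfE-x₀⟧ ⌜ x ⌝ acc | ⟦parityE-x₀⟧ ⌜ x ⌝ acc with x
    ... | gen i rewrite half-⌜gen⌝ i | parity-⌜gen⌝ i = refl
    ... | inv i rewrite half-⌜inv⌝ i | parity-⌜inv⌝ i = refl

  step-generatorStepE : ∀ acc k → step generatorStepE acc k ≡ consCode ⌜ gen k ⌝ acc
  step-generatorStepE acc k = cong (λ n → consCode n acc) (⟦+ₑ⟧ x₀ x₀ (k ∷ acc ∷ []))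

  step-inverseStepE : ∀ acc ℓ → step inverseStepE acc ℓ ≡ consCode ⌜ invert (decodeLetter ℓ) ⌝ acc
  step-inverseStepE acc ℓ with letterCode ℓ
  ... | x , refl rewrite decodeLetter-⌜⌝ x = byLetter x
    where
    byLetter : ∀ x → step inverseStepE acc ⌜ x ⌝ ≡ consCode ⌜ invert x ⌝ acc
    byLetter x rewrite ⟦+ₑ⟧ (halfE x₀) (halfE x₀) (⌜ x ⌝ ∷ acc ∷ []) | ⟦halfE-x₀⟧ ⌜ x ⌝ acc
                     | ⟦parityE-x₀⟧ ⌜ x ⌝ acc with x
    ... | gen i rewrite half-⌜gen⌝ i | parity-⌜gen⌝ i = refl
    ... | inv i rewrite half-⌜inv⌝ i | parity-⌜inv⌝ i = refl

  sideFold : Side → ℕ → ℕ → ℕ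
  sideFold s l acc = foldl (step (sideStepE s)) acc (decodeList l)

  -- the S-word x₀ followed by the letters of the given component; x₀ stands for the s₀ of ε = (s₀ , s₀)
  sidePart : Side → ℕ → ℕ
  sidePart s m = pair 0 (sideFold s m 0)

  sidePartE : Side → Expr 1
  sidePartE s = ⟨ lit 0 , foldlE (sideStepE s) x₀ (lit 0) ⟩

  ⟦sidePartE⟧ : ∀ s m → ⟦ sidePartE s ⟧ (m ∷ []) ≡ sidePart s m
  ⟦sidePartE⟧ s m = cong (pair 0) (⟦foldlE⟧ (sideStepE s) x₀ (lit 0) (m ∷ []))

  -- an S-word for (a₊ ∙ b₋) ∙ w: one leading x₀ for the s₀ in each component
  differenceWord : ℕ → ℕ → ℕ → ℕ
  differenceWord a b w =
    pair 0 (sideFold negative b (sideFold positive a (consCode 0 (consCode (fst w) (snd w)))))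

  differenceWordE : ∀ {n} → Expr n → Expr n → Expr n → Expr n
  differenceWordE a b w =
    ⟨ lit 0 , foldlE (sideStepE negative) b (foldlE (sideStepE positive) a (consE (lit 0) (consE (π₁ w) (π₂ w)))) ⟩

  ⟦differenceWordE⟧ : ∀ {n} (a b w : Expr n) ρ →
                      ⟦ differenceWordE a b w ⟧ ρ ≡ differenceWord (⟦ a ⟧ ρ) (⟦ b ⟧ ρ) (⟦ w ⟧ ρ)
  ⟦differenceWordE⟧ a b w ρ = cong (pair 0) (trans
    (⟦foldlE⟧ (sideStepE negative) b _ ρ)
    (cong (λ acc → foldl (step (sideStepE negative)) acc (decodeList (⟦ b ⟧ ρ)))
          (⟦foldlE⟧ (sideStepE positive) a _ ρ)))

  differencesE : Expr 2
  differencesE = ⟨ differenceWordE (π₁ x₀) (π₂ x₀) x₁ , differenceWordE (π₂ x₀) (π₁ x₀) x₁ ⟩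

  ⟦differencesE⟧ : ∀ a b w →
                   ⟦ differencesE ⟧ (pair a b ∷ w ∷ []) ≡ pair (differenceWord a b w) (differenceWord b a w)
  ⟦differencesE⟧ a b w rewrite ⟦differenceWordE⟧ {2} (π₁ x₀) (π₂ x₀) x₁ (pair a b ∷ w ∷ [])
                             | ⟦differenceWordE⟧ {2} (π₂ x₀) (π₁ x₀) x₁ (pair a b ∷ w ∷ [])
                             | fst-pair a b | snd-pair a b = refl

  generatorWord : ℕ → ℕ
  generatorWord n = foldl (step generatorStepE) (consCode ⌜ gen (fst n) ⌝ 0) (decodeList (snd n))

  generatorWordE : Expr 1
  generatorWordE = foldlE generatorStepE (π₂ x₀) (consE (π₁ x₀ +ₑ π₁ x₀) (lit 0))

  ⟦generatorWordE⟧ : ∀ n → ⟦ generatorWordE ⟧ (n ∷ []) ≡ generatorWord n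
  ⟦generatorWordE⟧ n rewrite ⟦foldlE⟧ generatorStepE (π₂ x₀) (consE (π₁ x₀ +ₑ π₁ x₀) (lit 0)) (n ∷ [])
                           | ⟦+ₑ⟧ (π₁ x₀) (π₁ x₀) (n ∷ []) = refl

  -- the F_ω-word u followed by the inverses of the letters of v
  combine : ℕ → ℕ → ℕ
  combine u v = foldl (step inverseStepE) u (decodeList v)

  combineE : Expr 1
  combineE = foldlE inverseStepE (π₂ x₀) (π₁ x₀)

  ⟦combineE⟧ : ∀ u v → ⟦ combineE ⟧ (pair u v ∷ []) ≡ combine u v
  ⟦combineE⟧ u v
    rewrite ⟦foldlE⟧ inverseStepE (π₂ x₀) (π₁ x₀) (pair u v ∷ []) | fst-pair u v | snd-pair u v = refl

module InducedMapProgram where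
  open import Data.Nat using (ℕ)
  open import Relation.Binary.PropositionalEquality
  open Evaluation
  open Expressions
  open Coding
  open WordPrograms

  inducedCode : Code → Code
  inducedCode c =
    cComp (program combineE) (cPair (cComp c (program (sidePartE positive))) (cComp c (program (sidePartE negative))))

  inducedCode-correct : ∀ {c F} → Computes c F → ∀ m →
                        inducedCode c ⊢ m ⇓ combine (F (sidePart positive m)) (F (sidePart negative m))
  inducedCode-correct {c} {F} c-computes m =
    ev-comp (ev-pair (ev-comp (side positive) (c-computes _)) (ev-comp (side negative) (c-computes _)))
            (⇓-respʳ-≡ (program-correct combineE _) (⟦combineE⟧ (F (sidePart positive m)) (F (sidePart negative m))))
    where
    side : ∀ s → program (sidePartE s) ⊢ m ⇓ sidePart s m
    side s = ⇓-respʳ-≡ (program-correct (sidePartE s) m) (⟦sidePartE⟧ s m)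

  inducedIndex : ℕ → ℕ
  inducedIndex i = ⌜cComp⌝ (encodeCode (program combineE))
                           (⌜cPair⌝ (⌜cComp⌝ i (encodeCode (program (sidePartE positive))))
                                    (⌜cComp⌝ i (encodeCode (program (sidePartE negative)))))

  decodeCode-inducedIndex : ∀ i → decodeCode (inducedIndex i) ≡ inducedCode (decodeCode i)
  decodeCode-inducedIndex i = begin
    decodeCode (inducedIndex i)
      ≡⟨ decodeCode-⌜cComp⌝ (encodeCode (program combineE)) (⌜cPair⌝ (⌜cComp⌝ i n₊) (⌜cComp⌝ i n₋)) ⟩
    cComp (decodeCode (encodeCode (program combineE))) (decodeCode (⌜cPair⌝ (⌜cComp⌝ i n₊) (⌜cComp⌝ i n₋)))
      ≡⟨ cong₂ cComp (decodeCode-encodeCode (program combineE))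
                     (decodeCode-⌜cPair⌝ (⌜cComp⌝ i n₊) (⌜cComp⌝ i n₋)) ⟩
    cComp (program combineE) (cPair (decodeCode (⌜cComp⌝ i n₊)) (decodeCode (⌜cComp⌝ i n₋)))
      ≡⟨ cong (cComp (program combineE)) (cong₂ cPair (onSide positive) (onSide negative)) ⟩
    inducedCode (decodeCode i) ∎
    where
    open ≡-Reasoning
    n₊ = encodeCode (program (sidePartE positive))
    n₋ = encodeCode (program (sidePartE negative))
    onSide : ∀ s → decodeCode (⌜cComp⌝ i (encodeCode (program (sidePartE s))))
                   ≡ cComp (decodeCode i) (program (sidePartE s))
    onSide s = trans (decodeCode-⌜cComp⌝ i (encodeCode (program (sidePartE s))))
                     (cong (cComp (decodeCode i)) (decodeCode-encodeCode (program (sidePartE s))))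

  inducedIndexE : Expr 1
  inducedIndexE =
    ⟨ lit 5 , ⟨ lit (encodeCode (program combineE)) , ⟨ lit 4 , ⟨ onSide positive , onSide negative ⟩ ⟩ ⟩ ⟩
    where
    onSide : Side → Expr 1
    onSide s = ⟨ lit 5 , ⟨ x₀ , lit (encodeCode (program (sidePartE s))) ⟩ ⟩

  inducedIndex-computable : ∀ i → Φ (encodeCode (program inducedIndexE)) i (inducedIndex i)
  inducedIndex-computable i = Φ-encodeCode (program inducedIndexE) (program-correct inducedIndexE i)

module WordEvaluation {a ℓ} (H : AbelianGroup a ℓ) where
  open import Data.Nat using (ℕ)
  open import Data.List using (List; []; _∷_; _++_; map; foldl)
  open import Function.Base using (_∘_)
  open import Relation.Binary.PropositionalEquality as ≡ using (_≡_)
  open import Algebra.Morphism.Structures using (module MagmaMorphisms)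
  open AbelianGroup H
  open import Algebra.Properties.AbelianGroup H using (⁻¹-∙-comm; ⁻¹-involutive; ε⁻¹≈ε)
  open import Algebra.Properties.CommutativeSemigroup commutativeSemigroup using (x∙yz≈yx∙z)
  open import Relation.Binary.Reasoning.Setoid setoid
  open import Data.List.Properties using (map-∘)
  open LetterCoding using (⌜_⌝; mapL≡map-decodeLetter)
  open BasicPrograms using (step)
  open WordPrograms using (invert; consCode; decodeF-consCode; combine; inverseStepE; step-inverseStepE)

  module _ (h : ℕ → Carrier) where
    eval : List Letter → Carrier
    eval = evalF rawGroup h

    letterValue : Letter → Carrier
    letterValue (gen i) = h i
    letterValue (inv i) = h i ⁻¹

    eval-∷ : ∀ x w → eval (x ∷ w) ≈ letterValue x ∙ eval w
    eval-∷ (gen i) w = refl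
    eval-∷ (inv i) w = refl

    eval-++ : ∀ w w′ → eval (w ++ w′) ≈ eval w ∙ eval w′
    eval-++ []      w′ = sym (identityˡ _)
    eval-++ (x ∷ w) w′ = begin
      eval (x ∷ w ++ w′)                 ≈⟨ eval-∷ x (w ++ w′) ⟩
      letterValue x ∙ eval (w ++ w′)     ≈⟨ ∙-congˡ (eval-++ w w′) ⟩
      letterValue x ∙ (eval w ∙ eval w′) ≈⟨ assoc _ _ _ ⟨
      (letterValue x ∙ eval w) ∙ eval w′ ≈⟨ ∙-congʳ (eval-∷ x w) ⟨
      eval (x ∷ w) ∙ eval w′             ∎

    letterValue-invert : ∀ x → letterValue (invert x) ≈ letterValue x ⁻¹
    letterValue-invert (gen i) = refl
    letterValue-invert (inv i) = sym (⁻¹-involutive (h i))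

    eval-map-invert : ∀ w → eval (map invert w) ≈ eval w ⁻¹
    eval-map-invert []      = sym ε⁻¹≈ε
    eval-map-invert (x ∷ w) = begin
      eval (invert x ∷ map invert w)               ≈⟨ eval-∷ (invert x) (map invert w) ⟩
      letterValue (invert x) ∙ eval (map invert w) ≈⟨ ∙-cong (letterValue-invert x) (eval-map-invert w) ⟩
      letterValue x ⁻¹ ∙ eval w ⁻¹                 ≈⟨ ⁻¹-∙-comm _ _ ⟩
      (letterValue x ∙ eval w) ⁻¹                  ≈⟨ ⁻¹-cong (eval-∷ x w) ⟨
      eval (x ∷ w) ⁻¹                              ∎

    eval-foldl-prepend : ∀ (τ : ℕ → Letter) (f : ℕ → ℕ → ℕ) → (∀ acc n → f acc n ≡ consCode ⌜ τ n ⌝ acc) →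
                         ∀ ns acc → eval (decodeF (foldl f acc ns)) ≈ eval (map τ ns) ∙ eval (decodeF acc)
    eval-foldl-prepend τ f f-prepends []       acc = sym (identityˡ _)
    eval-foldl-prepend τ f f-prepends (n ∷ ns) acc = begin
      eval (decodeF (foldl f (f acc n) ns))                  ≈⟨ eval-foldl-prepend τ f f-prepends ns (f acc n) ⟩
      eval (map τ ns) ∙ eval (decodeF (f acc n))             ≡⟨ ≡.cong (λ u → eval (map τ ns) ∙ eval u) prepended ⟩
      eval (map τ ns) ∙ eval (τ n ∷ decodeF acc)             ≈⟨ ∙-congˡ (eval-∷ (τ n) (decodeF acc)) ⟩
      eval (map τ ns) ∙ (letterValue (τ n) ∙ eval (decodeF acc)) ≈⟨ x∙yz≈yx∙z _ _ _ ⟩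
      (letterValue (τ n) ∙ eval (map τ ns)) ∙ eval (decodeF acc) ≈⟨ ∙-congʳ (eval-∷ (τ n) (map τ ns)) ⟨
      eval (map τ (n ∷ ns)) ∙ eval (decodeF acc)             ∎
      where
      prepended : decodeF (f acc n) ≡ τ n ∷ decodeF acc
      prepended = ≡.trans (≡.cong decodeF (f-prepends acc n)) (decodeF-consCode (τ n) acc)

    eval-combine : ∀ u v → eval (decodeF (combine u v)) ≈ eval (decodeF v) ⁻¹ ∙ eval (decodeF u)
    eval-combine u v = begin
      eval (decodeF (combine u v))
        ≈⟨ eval-foldl-prepend (invert ∘ decodeLetter) (step inverseStepE) step-inverseStepE (decodeList v) u ⟩
      eval (map (invert ∘ decodeLetter) (decodeList v)) ∙ eval (decodeF u)
        ≡⟨ ≡.cong (λ w → eval w ∙ eval (decodeF u)) invert-letters ⟩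
      eval (map invert (decodeF v)) ∙ eval (decodeF u) ≈⟨ ∙-congʳ (eval-map-invert (decodeF v)) ⟩
      eval (decodeF v) ⁻¹ ∙ eval (decodeF u)           ∎
      where
      invert-letters : map (invert ∘ decodeLetter) (decodeList v) ≡ map invert (decodeF v)
      invert-letters = ≡.trans (map-∘ (decodeList v))
                               (≡.cong (map invert) (≡.sym (mapL≡map-decodeLetter (decodeList v))))

  module _ {c ℓ′} (S : CommutativeSemigroup c ℓ′) (g : ℕ → CommutativeSemigroup.Carrier S)
           {φ : CommutativeSemigroup.Carrier S → Carrier}
           (φ-homo : MagmaMorphisms.IsMagmaHomomorphism (CommutativeSemigroup.rawMagma S) rawMagma φ) where
    open MagmaMorphisms.IsMagmaHomomorphism φ-homo using (homo)

    evalD′-homo : ∀ k ks → φ (evalD′ S g k ks) ≈ eval (φ ∘ g) (map gen (k ∷ ks))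
    evalD′-homo k []        = sym (identityʳ _)
    evalD′-homo k (k′ ∷ ks) = trans (homo _ _) (∙-congˡ (evalD′-homo k′ ks))

module GrothendieckPresentation {c ℓ} (S : CommutativeSemigroup c ℓ) (S# : SemigroupPres S) where
  open import Level using (_⊔_)
  open import Data.Nat using (ℕ)
  open import Function.Base using (id)
  import Algebra.Morphism.Construct.Identity as Identity
  open import Data.Product using (Σ; _×_; _,_; proj₁; proj₂)
  open import Data.List using (List; []; _∷_; _++_; map; foldl)
  open import Data.List.NonEmpty using (_∷_)
  open import Function.Bundles using (_⇔_; mk⇔; Equivalence)
  open import Relation.Binary.PropositionalEquality as ≡ using (_≡_)
  open CommutativeSemigroup S
  open import Algebra.Properties.CommutativeSemigroup S using (x∙yz≈y∙xz; xy∙z≈y∙xz)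
  open CantorPairing
  open import Algebra.Morphism.Structures using (module MagmaMorphisms; module GroupMorphisms)
  open Evaluation using (⇓-respʳ-≡)
  open Expressions using (program; program-correct)
  open Coding using (decodeList-cons; encodeD; decodeD-encodeD; encodeCode; Φ-encodeCode; Φ-encodeCode⁻¹)
  open BasicPrograms using (step)
  open InducedMapProgram
  open WordPrograms
  open SemigroupPres S# using (surj) renaming (gens to g; label to labelˢ)

  s₀ : Carrier
  s₀ = g 0

  open GrothendieckGroup S s₀ public
  private
    module 𝔾 = AbelianGroup grothendieckGroup
    open module W = WordEvaluation grothendieckGroup using (eval)

  gensᴳ : ℕ → Carrier × Carrier
  gensᴳ k = γ S (g k)

  private
    eval-map-gen : ∀ k ks → eval gensᴳ (map gen (k ∷ ks)) 𝔾.≈ γ S (evalD′ S g k ks)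
    eval-map-gen k ks = 𝔾.sym (W.evalD′-homo S g γ-isMagmaHomomorphism k ks)

  presentation : GroupPres 𝒢
  presentation = record { gens = gensᴳ ; surj = λ p → difference p }
    where
    open import Relation.Binary.Reasoning.Setoid 𝔾.setoid
    difference : ∀ p → Σ (List Letter) λ w → eval gensᴳ w 𝔾.≈ p
    difference (a , b) with surj a | surj b
    ... | x ∷ xs , wa≈a | y ∷ ys , wb≈b = word , (begin
      eval gensᴳ word                                            ≈⟨ W.eval-++ gensᴳ (map gen (x ∷ xs)) _ ⟩
      eval gensᴳ (map gen (x ∷ xs)) · eval gensᴳ (map invert (map gen (y ∷ ys)))
                                                                 ≈⟨ 𝔾.∙-congˡ (W.eval-map-invert gensᴳ (map gen (y ∷ ys))) ⟩
      eval gensᴳ (map gen (x ∷ xs)) · eval gensᴳ (map gen (y ∷ ys)) ⁻¹ᴳ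
                                          ≈⟨ 𝔾.∙-cong (eval-map-gen x xs) (𝔾.⁻¹-cong (eval-map-gen y ys)) ⟩
      γ S (evalD′ S g x xs) · γ S (evalD′ S g y ys) ⁻¹ᴳ   ≈⟨ 𝔾.∙-cong (γ-cong wa≈a) (𝔾.⁻¹-cong (γ-cong wb≈b)) ⟩
      γ S a · γ S b ⁻¹ᴳ                                  ≈⟨ 𝔾.sym (pair≈γ-γ⁻¹ a b) ⟩
      (a , b)                                             ∎)
      where
      word = map gen (x ∷ xs) ++ map invert (map gen (y ∷ ys))

  labelᴳ : ℕ → Carrier × Carrier
  labelᴳ = GroupPres.label presentation

  γ-label : ∀ n → γ S (labelˢ n) 𝔾.≈ labelᴳ (generatorWord n)
  γ-label n = begin
    γ S (evalD′ S g (fst n) ks)                       ≈⟨ eval-map-gen (fst n) ks ⟨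
    eval gensᴳ (map gen (fst n ∷ ks))                  ≈⟨ W.eval-++ gensᴳ (gen (fst n) ∷ []) (map gen ks) ⟩
    eval gensᴳ (gen (fst n) ∷ []) · eval gensᴳ (map gen ks) ≈⟨ 𝔾.comm _ _ ⟩
    eval gensᴳ (map gen ks) · eval gensᴳ (gen (fst n) ∷ [])
      ≡⟨ ≡.cong (λ w → eval gensᴳ (map gen ks) · eval gensᴳ w) (decodeF-consCode (gen (fst n)) 0) ⟨
    eval gensᴳ (map gen ks) · labelᴳ (consCode ⌜ gen (fst n) ⌝ 0)
      ≈⟨ W.eval-foldl-prepend gensᴳ gen (step generatorStepE) step-generatorStepE ks _ ⟨
    labelᴳ (generatorWord n)                          ∎
    where
    open import Relation.Binary.Reasoning.Setoid 𝔾.setoid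
    open LetterCoding using (⌜_⌝)
    ks = decodeList (snd n)

  component : Side → Carrier × Carrier → Carrier
  component positive = proj₁
  component negative = proj₂

  letterPart : Side → Letter → Carrier
  letterPart positive (gen i) = g i ∙ g i
  letterPart positive (inv i) = g i
  letterPart negative (gen i) = g i
  letterPart negative (inv i) = g i ∙ g i

  parts : Side → List Letter → Carrier → Carrier
  parts s []      y = y
  parts s (x ∷ w) y = letterPart s x ∙ parts s w y

  component-eval : ∀ s w → component s (eval gensᴳ w) ≡ parts s w s₀
  component-eval positive []          = ≡.refl
  component-eval negative []          = ≡.refl
  component-eval positive (gen i ∷ w) = ≡.cong (g i ∙ g i ∙_) (component-eval positive w)
  component-eval positive (inv i ∷ w) = ≡.cong (g i ∙_) (component-eval positive w)
  component-eval negative (gen i ∷ w) = ≡.cong (g i ∙_) (component-eval negative w)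
  component-eval negative (inv i ∷ w) = ≡.cong (g i ∙ g i ∙_) (component-eval negative w)

  parts-cong : ∀ s w {y z} → y ≈ z → parts s w y ≈ parts s w z
  parts-cong s []      y≈z = y≈z
  parts-cong s (x ∷ w) y≈z = ∙-congˡ (parts-cong s w y≈z)

  parts-∙ʳ : ∀ s w y z → parts s w y ∙ z ≈ parts s w (y ∙ z)
  parts-∙ʳ s []      y z = refl
  parts-∙ʳ s (x ∷ w) y z = trans (assoc _ _ _) (∙-congˡ (parts-∙ʳ s w y z))

  parts-∙ˡ : ∀ s w y z → parts s w (y ∙ z) ≈ y ∙ parts s w z
  parts-∙ˡ s w y z = trans (parts-cong s w (comm y z)) (trans (sym (parts-∙ʳ s w z y)) (comm _ _))

  wordValue : ℕ → ℕ → Carrier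
  wordValue h l = evalD′ S g h (decodeList l)

  labelˢ-pair : ∀ h l → labelˢ (pair h l) ≡ wordValue h l
  labelˢ-pair h l rewrite fst-pair h l | snd-pair h l = ≡.refl

  wordValue-consCode : ∀ h k l → wordValue h (consCode k l) ≡ g h ∙ wordValue k l
  wordValue-consCode h k l = ≡.cong (evalD′ S g h) (decodeList-cons k l)

  wordValue-insert : ∀ h k l → wordValue h (consCode k l) ≈ g k ∙ wordValue h l
  wordValue-insert h k l rewrite wordValue-consCode h k l with decodeList l
  ... | []    = comm (g h) (g k)
  ... | m ∷ _ = x∙yz≈y∙xz (g h) (g k) _

  wordValue-partCode : ∀ s x h l → wordValue h (partCode s x l) ≈ letterPart s x ∙ wordValue h l
  wordValue-partCode positive (gen i) h l = insertTwice h i l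
    where
    insertTwice : ∀ h i l → wordValue h (consCode i (consCode i l)) ≈ (g i ∙ g i) ∙ wordValue h l
    insertTwice h i l = trans (wordValue-insert h i _) (trans (∙-congˡ (wordValue-insert h i l)) (sym (assoc _ _ _)))
  wordValue-partCode positive (inv i) h l = wordValue-insert h i l
  wordValue-partCode negative (gen i) h l = wordValue-insert h i l
  wordValue-partCode negative (inv i) h l =
    trans (wordValue-insert h i _) (trans (∙-congˡ (wordValue-insert h i l)) (sym (assoc _ _ _)))

  wordValue-sideFold : ∀ s ns h l → wordValue h (foldl (step (sideStepE s)) l ns) ≈ parts s (mapL ns) (wordValue h l)
  wordValue-sideFold s []       h l = refl
  wordValue-sideFold s (n ∷ ns) h l = begin
    wordValue h (foldl (step (sideStepE s)) (step (sideStepE s) l n) ns)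
      ≈⟨ wordValue-sideFold s ns h _ ⟩
    parts s (mapL ns) (wordValue h (step (sideStepE s) l n))
      ≡⟨ ≡.cong (λ k → parts s (mapL ns) (wordValue h k)) (step-sideStepE s l n) ⟩
    parts s (mapL ns) (wordValue h (partCode s (decodeLetter n) l))
      ≈⟨ parts-cong s (mapL ns) (wordValue-partCode s (decodeLetter n) h l) ⟩
    parts s (mapL ns) (letterPart s (decodeLetter n) ∙ wordValue h l)
      ≈⟨ parts-∙ˡ s (mapL ns) _ _ ⟩
    letterPart s (decodeLetter n) ∙ parts s (mapL ns) (wordValue h l) ∎
    where open import Relation.Binary.Reasoning.Setoid setoid

  label-sidePart : ∀ s m → labelˢ (sidePart s m) ≈ component s (labelᴳ m)
  label-sidePart s m = begin
    labelˢ (sidePart s m)              ≡⟨ labelˢ-pair 0 (sideFold s m 0) ⟩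
    wordValue 0 (sideFold s m 0)       ≈⟨ wordValue-sideFold s (decodeList m) 0 0 ⟩
    parts s (decodeF m) s₀             ≡⟨ component-eval s (decodeF m) ⟨
    component s (labelᴳ m)             ∎
    where open import Relation.Binary.Reasoning.Setoid setoid

  label-differenceWord : ∀ a b w → labelˢ (differenceWord a b w) ≈
                         (component positive (labelᴳ a) ∙ component negative (labelᴳ b)) ∙ labelˢ w
  label-differenceWord a b w = begin
    labelˢ (differenceWord a b w)                   ≡⟨ labelˢ-pair 0 (sideFold negative b (sideFold positive a initial)) ⟩
    wordValue 0 (sideFold negative b (sideFold positive a initial))
      ≈⟨ wordValue-sideFold negative (decodeList b) 0 _ ⟩
    parts negative B (wordValue 0 (sideFold positive a initial))
      ≈⟨ parts-cong negative B (wordValue-sideFold positive (decodeList a) 0 initial) ⟩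
    parts negative B (parts positive A (wordValue 0 initial))
      ≡⟨ ≡.cong (λ v → parts negative B (parts positive A v)) initial-value ⟩
    parts negative B (parts positive A (s₀ ∙ (s₀ ∙ y)))
      ≈⟨ parts-cong negative B (parts-∙ˡ positive A s₀ (s₀ ∙ y)) ⟩
    parts negative B (s₀ ∙ parts positive A (s₀ ∙ y))
      ≈⟨ parts-∙ʳ negative B s₀ _ ⟨
    parts negative B s₀ ∙ parts positive A (s₀ ∙ y)
      ≈⟨ ∙-congˡ (parts-∙ʳ positive A s₀ y) ⟨
    parts negative B s₀ ∙ (parts positive A s₀ ∙ y)
      ≈⟨ xy∙z≈y∙xz _ _ y ⟨
    (parts positive A s₀ ∙ parts negative B s₀) ∙ y
      ≡⟨ ≡.cong₂ (λ p q → (p ∙ q) ∙ y) (component-eval positive A) (component-eval negative B) ⟨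
    (component positive (labelᴳ a) ∙ component negative (labelᴳ b)) ∙ y ∎
    where
    open import Relation.Binary.Reasoning.Setoid setoid
    A = decodeF a
    B = decodeF b
    y = labelˢ w
    initial = consCode 0 (consCode (fst w) (snd w))
    initial-value : wordValue 0 initial ≡ s₀ ∙ (s₀ ∙ y)
    initial-value = ≡.trans (wordValue-consCode 0 0 (consCode (fst w) (snd w)))
                            (≡.cong (s₀ ∙_) (wordValue-consCode 0 (fst w) (snd w)))

  labelᴳ-≈⇔ : ∀ a b → labelᴳ a ≈ᴳ labelᴳ b ⇔
                       Σ ℕ λ w → labelˢ (differenceWord a b w) ≈ labelˢ (differenceWord b a w)
  labelᴳ-≈⇔ a b = mk⇔ to from
    where
    open import Relation.Binary.Reasoning.Setoid setoid
    to : labelᴳ a ≈ᴳ labelᴳ b → Σ ℕ λ w → labelˢ (differenceWord a b w) ≈ labelˢ (differenceWord b a w)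
    to (z , p) = w , (begin
      labelˢ (differenceWord a b w)           ≈⟨ label-differenceWord a b w ⟩
      (proj₁ (labelᴳ a) ∙ proj₂ (labelᴳ b)) ∙ labelˢ w ≈⟨ ∙-congˡ w-labels-z ⟩
      (proj₁ (labelᴳ a) ∙ proj₂ (labelᴳ b)) ∙ z ≈⟨ p ⟩
      (proj₁ (labelᴳ b) ∙ proj₂ (labelᴳ a)) ∙ z ≈⟨ ∙-congˡ w-labels-z ⟨
      (proj₁ (labelᴳ b) ∙ proj₂ (labelᴳ a)) ∙ labelˢ w ≈⟨ label-differenceWord b a w ⟨
      labelˢ (differenceWord b a w)           ∎)
      where
      w = encodeD (proj₁ (surj z))
      w-labels-z : labelˢ w ≈ z
      w-labels-z = trans (reflexive (≡.cong (evalD S g) (decodeD-encodeD (proj₁ (surj z))))) (proj₂ (surj z))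
    from : (Σ ℕ λ w → labelˢ (differenceWord a b w) ≈ labelˢ (differenceWord b a w)) → labelᴳ a ≈ᴳ labelᴳ b
    from (w , q) = labelˢ w , trans (sym (label-differenceWord a b w)) (trans q (label-differenceWord b a w))

  presentation-ce : CESemigroupPres S S# → CEGroupPres 𝒢 presentation
  presentation-ce (e , enumerates) = encodeCode search , λ a b → mk⇔ (to a b) (from a b)
    where
    open HaltingSearch using (searchHalting; searchHalting-halts⇔)
    search : Code
    search = searchHalting (decodeCode e) differencesE

    halts⇔ = searchHalting-halts⇔ (decodeCode e) differencesE

    to : ∀ a b → labelᴳ a ≈ᴳ labelᴳ b → Σ ℕ λ y → Φ (encodeCode search) (pair a b) y
    to a b a≈b with Equivalence.to (labelᴳ-≈⇔ a b) a≈b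
    ... | w , same-label with Equivalence.to (enumerates (differenceWord a b w) (differenceWord b a w)) same-label
    ...   | y , halts = proj₁ found , Φ-encodeCode search (proj₂ found)
      where
      found : Σ ℕ λ y′ → search ⊢ pair a b ⇓ y′
      found = Equivalence.from (halts⇔ (pair a b))
                (w , y , ≡.subst (λ x → decodeCode e ⊢ x ⇓ y) (≡.sym (⟦differencesE⟧ a b w)) halts)

    from : ∀ a b → (Σ ℕ λ y → Φ (encodeCode search) (pair a b) y) → labelᴳ a ≈ᴳ labelᴳ b
    from a b (y , found) with Equivalence.to (halts⇔ (pair a b)) (y , Φ-encodeCode⁻¹ search found)
    ... | w , y′ , halts = Equivalence.from (labelᴳ-≈⇔ a b) (w , Equivalence.from
      (enumerates (differenceWord a b w) (differenceWord b a w))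
      (y′ , ≡.subst (λ x → decodeCode e ⊢ x ⇓ y′) (⟦differencesE⟧ a b w) halts))

  γ-computable : Σ ℕ λ e → IsIndex _≈ᴳ_ labelˢ labelᴳ (γ S) e
  γ-computable = encodeCode (program generatorWordE) , λ n →
    generatorWord n ,
    Φ-encodeCode (program generatorWordE) (⇓-respʳ-≡ (program-correct generatorWordE n) (⟦generatorWordE⟧ n)) ,
    γ-label n

  module _ {h ℓh} (H : AbelianGroup h ℓh) (H# : GroupPres (AbelianGroup.rawGroup H))
           {φ : Carrier → AbelianGroup.Carrier H}
           (φ-homo : MagmaMorphisms.IsMagmaHomomorphism rawMagma (AbelianGroup.rawMagma H) φ)
           {ψ : Carrier × Carrier → AbelianGroup.Carrier H}
           (ψ-homo : GroupMorphisms.IsGroupHomomorphism 𝒢 (AbelianGroup.rawGroup H) ψ)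
           (ψ∘γ≈φ : ∀ s → AbelianGroup._≈_ H (ψ (γ S s)) (φ s)) where
    open AbelianGroup H using () renaming (_≈_ to _≈ᴴ_; _∙_ to _∙ᴴ_; _⁻¹ to _⁻¹ᴴ)
    open GroupPres H# using () renaming (label to labelᴴ)

    ψ-label : ∀ (F : ℕ → ℕ) → (∀ n → φ (labelˢ n) ≈ᴴ labelᴴ (F n)) →
              ∀ m → ψ (labelᴳ m) ≈ᴴ labelᴴ (combine (F (sidePart positive m)) (F (sidePart negative m)))
    ψ-label F F-labels m = begin
      ψ (labelᴳ m)                           ≈⟨ ψ.⟦⟧-cong (pair≈γ-γ⁻¹ A₊ A₋) ⟩
      ψ (γ S A₊ · γ S A₋ ⁻¹ᴳ)                ≈⟨ ψ.homo _ _ ⟩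
      ψ (γ S A₊) ∙ᴴ ψ (γ S A₋ ⁻¹ᴳ)           ≈⟨ H.∙-congˡ (ψ.⁻¹-homo _) ⟩
      ψ (γ S A₊) ∙ᴴ ψ (γ S A₋) ⁻¹ᴴ           ≈⟨ H.∙-cong (ψ∘γ≈φ A₊) (H.⁻¹-cong (ψ∘γ≈φ A₋)) ⟩
      φ A₊ ∙ᴴ φ A₋ ⁻¹ᴴ                       ≈⟨ H.∙-cong (on positive) (H.⁻¹-cong (on negative)) ⟩
      labelᴴ (F X₊) ∙ᴴ labelᴴ (F X₋) ⁻¹ᴴ     ≈⟨ H.comm _ _ ⟩
      labelᴴ (F X₋) ⁻¹ᴴ ∙ᴴ labelᴴ (F X₊)     ≈⟨ WordEvaluation.eval-combine H (GroupPres.gens H#) (F X₊) (F X₋) ⟨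
      labelᴴ (combine (F X₊) (F X₋))          ∎
      where
      module H = AbelianGroup H
      module ψ = GroupMorphisms.IsGroupHomomorphism ψ-homo
      module φ = MagmaMorphisms.IsMagmaHomomorphism φ-homo
      open import Relation.Binary.Reasoning.Setoid H.setoid
      A₊ = proj₁ (labelᴳ m)
      A₋ = proj₂ (labelᴳ m)
      X₊ = sidePart positive m
      X₋ = sidePart negative m
      on : ∀ s → φ (component s (labelᴳ m)) ≈ᴴ labelᴴ (F (sidePart s m))
      on s = H.trans (φ.⟦⟧-cong (sym (label-sidePart s m))) (F-labels (sidePart s m))

  presentation-universal : IsUniversal S S# presentation
  presentation-universal = γ-computable , encodeCode (program inducedIndexE) ,
    λ H H# _ φ φ-homo ψ ψ-homo ψ∘γ≈φ i i-indexes-φ →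
      let F = λ n → proj₁ (i-indexes-φ n)
          F-computed = λ n → proj₁ (proj₂ (i-indexes-φ n))
          ψ-value = λ m → combine (F (sidePart positive m)) (F (sidePart negative m))
      in inducedIndex i , inducedIndex-computable i , λ m →
           ψ-value m ,
           ≡.subst (λ c → c ⊢ m ⇓ ψ-value m) (≡.sym (decodeCode-inducedIndex i)) (inducedCode-correct F-computed m) ,
           ψ-label H H# φ-homo ψ-homo ψ∘γ≈φ F (λ n → proj₂ (proj₂ (i-indexes-φ n))) m

  private
    id-homo : GroupMorphisms.IsGroupHomomorphism 𝒢 𝒢 id
    id-homo = Identity.isGroupHomomorphism 𝒢 𝔾.refl

  -- For H = 𝒢(S) and φ = γ the induced ψ is the identity, so universality of P transports
  -- the index of γ into Q to an index of the identity from P to Q.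
  identity-computable : (P Q : GroupPres 𝒢) → CEGroupPres 𝒢 Q → IsUniversal S S# P → IsUniversal S S# Q →
                        Σ ℕ λ e → IsIndex _≈ᴳ_ (GroupPres.label P) (GroupPres.label Q) id e
  identity-computable P Q Q-ce P-universal Q-universal =
    let i , i-indexes-γ = proj₁ (Q-universal {c} {c ⊔ ℓ})
        _ , transfer = proj₂ (P-universal {c} {c ⊔ ℓ})
        j , _ , j-indexes-id = transfer grothendieckGroup Q Q-ce (γ S) γ-isMagmaHomomorphism
                                        id id-homo (λ _ → 𝔾.refl) i i-indexes-γ
    in j , j-indexes-id

  universal-unique : (P Q : GroupPres 𝒢) → CEGroupPres 𝒢 P → CEGroupPres 𝒢 Q →
                     IsUniversal S S# P → IsUniversal S S# Q → ComputablyIsomorphic S S# P Q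
  universal-unique P Q P-ce Q-ce P-universal Q-universal =
    id , id , id-homo , id-homo , (λ _ → 𝔾.refl) , (λ _ → 𝔾.refl) ,
    identity-computable P Q Q-ce P-universal Q-universal , identity-computable Q P P-ce Q-universal P-universal

proposition2p14 : ∀ {c ℓ} (S : CommutativeSemigroup c ℓ) (S# : SemigroupPres S) →
                    CESemigroupPres S S# → UniversalGrothendieck S S#
proposition2p14 S S# S#-ce = record
  { pres      = presentation
  ; pres-ce   = presentation-ce S#-ce
  ; universal = presentation-universal
  ; unique    = universal-unique
  }
  where open GrothendieckPresentation S S#
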